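{- Let $n \ge r \ge s \ge 0$ be integers and let $F \subseteq \binom{[n]}{r}$ be such that $\mathrm{rk}\, M_s^r(K_n^r - F) < \binom{n}{s}$ and \[ (n-r-s)\left(\binom{n}{r} - |F|\right) \geq |F|\binom{r}{s}\binom{n-r+s}{s}. \] Then for every dependence sequence of $G = K_n^r - F$, the associated $s$-graph $G'$ has an independent set of size at least \[ n - \frac{|F|\binom{r}{s}\binom{n-r+s}{s}}{\binom{n}{r} - |F|}. \]
   Context: $K_n^r - F$ denotes the $r$-graph on vertex set $V=[n]$ with edge set $\binom{[n]}{r}\setminus F$. For an $r$-graph $G$ and $0\le s\le r$, the higher inclusion matrix $M_s^r(G)$ is the $\{0,1\}$-matrix with rows indexed by the edges of $G$ and columns indexed by the $s$-subsets of $V(G)$, the entry $c_S(G)_e$ for edge $e$ and $s$-set $S$ being $1$ if $S \subseteq e$ and $0$ otherwise; $\mathrm{rk}$ is rank over the reals. A sequence $\{\alpha_S\}_{S \in \binom{V}{s}}$ of reals is a dependence sequence for $G$ if $\sum_{S} \alpha_S c_S(G)_e = 0$ for every edge $e$ of $G$. Its associated $s$-graph $G'$ has vertex set $V$ and edge set $\{S \in \binom{V}{s} : \alpha_S \neq 0\}$. A set of vertices is independent in $G'$ if it contains no edge of $G'$.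
   Formalization: The dependence sequences have rational terms only, and the rank of $M_s^r(K_n^r - F)$ is taken over ℚ rather than over the reals. -}

module Defs where

open import Data.Nat as ℕ using (ℕ; zero; suc)
open import Data.Bool using (Bool; true; false)
open import Data.Vec using (Vec; []; _∷_)
open import Data.List using (List; []; _∷_; map; _++_; filter; length; foldr)
open import Data.List.Membership.Propositional using (_∈_)
open import Data.List.Relation.Unary.All using (All)
open import Data.List.Relation.Unary.Unique.Propositional using (Unique)
open import Data.Fin.Subset using (Subset; _⊆_; ∣_∣)
open import Data.Fin.Subset.Properties using (_⊆?_)
open import Data.Rational using (ℚ; 0ℚ; 1ℚ; _+_; _*_)
open import Data.Product using (Σ; _×_)
open import Relation.Nullary using (¬_; yes; no)
open import Relation.Binary.PropositionalEquality using (_≡_)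

allSubsets : (n : ℕ) → List (Subset n)
allSubsets zero = [] ∷ []
allSubsets (suc n) = map (false ∷_) (allSubsets n) ++ map (true ∷_) (allSubsets n)

kSets : (n k : ℕ) → List (Subset n)
kSets n k = filter (λ S → ∣ S ∣ ℕ.≟ k) (allSubsets n)

IsEdge : ∀ {n} → ℕ → List (Subset n) → Subset n → Set
IsEdge r F e = (∣ e ∣ ≡ r) × ¬ (e ∈ F)

c : ∀ {n} → Subset n → Subset n → ℚ
c S e with S ⊆? e
... | yes _ = 1ℚ
... | no _ = 0ℚ

sumℚ : List ℚ → ℚ
sumℚ = foldr _+_ 0ℚ

-- the columns of M_s^r(K_n^r - F) indexed by the list cols are linearly independent
ColumnsIndependent : ∀ {n} (r : ℕ) (F : List (Subset n)) (cols : List (Subset n)) → Set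
ColumnsIndependent {n} r F cols =
  (β : Subset n → ℚ) →
  (∀ e → IsEdge r F e → sumℚ (map (λ S → β S * c S e) cols) ≡ 0ℚ) →
  ∀ S → S ∈ cols → β S ≡ 0ℚ

-- rk M_s^r(K_n^r - F) ≥ k : there are k distinct columns that are linearly independent
RankAtLeast : ∀ {n} (r s : ℕ) (F : List (Subset n)) (k : ℕ) → Set
RankAtLeast {n} r s F k =
  Σ (List (Subset n)) λ cols →
    Unique cols × All (λ S → ∣ S ∣ ≡ s) cols × (length cols ≡ k) × ColumnsIndependent r F cols

-- dependence sequence {α_S}_{S ∈ ([n] choose s)} for K_n^r - F
-- (α is given on all subsets, only its values on s-sets matter)
IsDependenceSeq : ∀ {n} (r s : ℕ) (F : List (Subset n)) (α : Subset n → ℚ) → Set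
IsDependenceSeq {n} r s F α =
  ∀ e → IsEdge r F e → sumℚ (map (λ S → α S * c S e) (kSets n s)) ≡ 0ℚ

-- I is independent in the associated s-graph G' (edges: s-sets S with α_S ≠ 0)
IndependentIn : ∀ {n} (s : ℕ) (α : Subset n → ℚ) (I : Subset n) → Set
IndependentIn s α I = ∀ S → ∣ S ∣ ≡ s → ¬ (α S ≡ 0ℚ) → ¬ (S ⊆ I)

-- Write u = r ∸ s and call f ∈ F close to an edge e of G = K_n^r − F when ∣ f ∩ e ∣ ≥ u. Removing
-- one point of f ─ e for every f close to e leaves a set I ⊇ e that contains no close f. If
-- ∣ I ∣ ≥ r + s, then every s-set S ⊆ I lies in an (r + s)-set W with e ∪ S ⊆ W ⊆ I; any two
-- r-subsets of W share ≥ u points, so all r-subsets of W are edges of G, and since the s-versus-r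
-- inclusion matrix of an (r + s)-set has trivial kernel (Gottlieb–Kantor), α vanishes on S.
-- A fixed r-set f is close to at most C(r,s) C(n−r+s,s) r-sets, so double counting gives an edge e
-- with at most ∣F∣ C(r,s) C(n−r+s,s) / (C(n,r) − ∣F∣) close members of F, whence the bound on ∣ I ∣.
module Submission where

open import Algebra.Bundles using (CommutativeMonoid)
open import Data.Bool as Bool using (true; false)
open import Data.Empty using (⊥-elim) renaming (⊥ to Empty)
open import Data.Fin using (Fin; zero; suc)
import Data.Fin.Properties as FinP
open import Data.Fin.Subset using (Subset; Nonempty; ∣_∣; _⊆_; _∈_; _∉_; _∪_; _∩_; _─_; _-_; ⁅_⁆; ⊥; ∁; ⋃)
open import Data.Fin.Subset.Properties
open import Data.Integer as ℤ using (+_)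
import Data.Integer.Properties as ℤP
open import Data.List using (List; []; _∷_; map; _++_; filter; length)
import Data.List.Properties as ListP
open import Data.List.Membership.Propositional using () renaming (_∈_ to _∈ₗ_)
open import Data.List.Membership.Propositional.Properties using (∈-filter⁻; ∈-filter⁺; ∈-map⁻; ∈-map⁺)
open import Data.List.Relation.Unary.All as All using (All)
import Data.List.Relation.Unary.AllPairs as AllPairs
open import Data.List.Relation.Unary.Any using (here; there; any?)
open import Data.List.Relation.Unary.Unique.Propositional using (Unique)
import Data.List.Relation.Unary.Unique.Propositional.Properties as UniqueP
open import Data.Nat as ℕ using (ℕ; zero; suc; _+_; _*_; _∸_; _≤_; _<_; z≤n; s≤s)
open import Data.Nat.Combinatorics using (_C_; nCk+nC[k+1]≡[n+1]C[k+1]; nCk≡nC[n∸k])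
open import Data.Nat.ListAction using (sum)
import Data.Nat.Properties as ℕP
open import Data.Product using (Σ; ∃; _×_; _,_; proj₁; proj₂)
open import Data.Rational as ℚ using (ℚ; 0ℚ)
import Data.Rational.Properties as ℚP
open import Data.Rational.Solver using (module +-*-Solver)
open import Data.Sum using (inj₁; inj₂)
open import Data.Vec using ([]; _∷_; here; there)
import Data.Vec.Properties as VecP
open import Function using (_∘_)
open import Relation.Binary.Definitions using (DecidableEquality; tri<; tri≈; tri>)
open import Relation.Binary.PropositionalEquality
open import Relation.Nullary using (¬_; Dec; yes; no; does; ¬?; contradiction)
open import Relation.Unary using (Pred; Decidable)

open import Defs

open +-*-Solver using (solve; _:+_; _:-_; _:=_)
open import Algebra.Properties.CommutativeSemigroup ℕP.+-commutativeSemigroup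
  using () renaming (x∙yz≈y∙xz to +-exchange)
open import Algebra.Properties.CommutativeSemigroup
  (CommutativeMonoid.commutativeSemigroup ℚP.+-0-commutativeMonoid)
  using () renaming (interchange to ℚ-interchange; xy∙z≈xz∙y to ℚ-xy∙z≈xz∙y)
open import Algebra.Properties.Group ℚP.+-0-group using () renaming (x∙y⁻¹≈ε⇒x≈y to ℚ-x∙y⁻¹≈ε⇒x≈y)
open import Algebra.Properties.Monoid.Mult ℚP.+-0-monoid using (×-homo-+) renaming (_×_ to _·_)

count : ∀ {a p} {A : Set a} {P : Pred A p} → Decidable P → List A → ℕ
count P? xs = length (filter P? xs)

module _ {a} {A : Set a} where

  filter-map : ∀ {b p} {B : Set b} {P : Pred B p} (P? : Decidable P) (f : A → B) xs →
    filter P? (map f xs) ≡ map f (filter (P? ∘ f) xs)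
  filter-map P? f [] = refl
  filter-map P? f (x ∷ xs) with does (P? (f x))
  ... | true = cong (f x ∷_) (filter-map P? f xs)
  ... | false = filter-map P? f xs

  count-none : ∀ {p} {P : Pred A p} (P? : Decidable P) {xs} → All (¬_ ∘ P) xs → count P? xs ≡ 0
  count-none P? ¬Ps = cong length (ListP.filter-none P? ¬Ps)

  count+count-¬ : ∀ {p} {P : Pred A p} (P? : Decidable P) xs →
    count P? xs + count (¬? ∘ P?) xs ≡ length xs
  count+count-¬ P? [] = refl
  count+count-¬ P? (x ∷ xs) with P? x
  ... | yes _ = cong suc (count+count-¬ P? xs)
  ... | no _ = trans (ℕP.+-suc _ _) (cong suc (count+count-¬ P? xs))

  count≤sum : ∀ {p} {P : Pred A p} (P? : Decidable P) (g : A → ℕ) → (∀ x → P x → 1 ≤ g x) →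
    ∀ xs → count P? xs ≤ sum (map g xs)
  count≤sum P? g P⇒1≤g [] = z≤n
  count≤sum P? g P⇒1≤g (x ∷ xs) with P? x
  ... | yes px = ℕP.+-mono-≤ (P⇒1≤g x px) (count≤sum P? g P⇒1≤g xs)
  ... | no _ = ℕP.≤-trans (count≤sum P? g P⇒1≤g xs) (ℕP.m≤n+m _ (g x))

  Unique⇒count≤1 : (_≟_ : DecidableEquality A) (y : A) {xs : List A} → Unique xs →
    count (_≟ y) xs ≤ 1
  Unique⇒count≤1 _≟_ y {[]} _ = z≤n
  Unique⇒count≤1 _≟_ y {x ∷ xs} (x∉xs AllPairs.∷ unique) with x ≟ y
  ... | yes refl = s≤s (ℕP.≤-reflexive (count-none (_≟ y) (All.map (λ x≢z z≡x → x≢z (sym z≡x)) x∉xs)))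
  ... | no _ = Unique⇒count≤1 _≟_ y unique

  sum-≤-length* : (g : A → ℕ) (c : ℕ) → ∀ xs → (∀ x → x ∈ₗ xs → g x ≤ c) → sum (map g xs) ≤ length xs * c
  sum-≤-length* g c [] _ = z≤n
  sum-≤-length* g c (x ∷ xs) g≤c =
    ℕP.+-mono-≤ (g≤c x (here refl)) (sum-≤-length* g c xs (λ y y∈ → g≤c y (there y∈)))

  sum-filter-≤ : ∀ {p} {P : Pred A p} (P? : Decidable P) (g : A → ℕ) xs →
    sum (map g (filter P? xs)) ≤ sum (map g xs)
  sum-filter-≤ P? g [] = z≤n
  sum-filter-≤ P? g (x ∷ xs) with does (P? x)
  ... | true = ℕP.+-monoʳ-≤ (g x) (sum-filter-≤ P? g xs)
  ... | false = ℕP.≤-trans (sum-filter-≤ P? g xs) (ℕP.m≤n+m _ (g x))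

  ∃-≤-average : (g : A → ℕ) → ∀ xs → 1 ≤ length xs → ∃ λ y → y ∈ₗ xs × g y * length xs ≤ sum (map g xs)
  ∃-≤-average g (x ∷ []) _ =
    x , here refl , ℕP.≤-reflexive (trans (ℕP.*-identityʳ (g x)) (sym (ℕP.+-identityʳ (g x))))
  ∃-≤-average g (x ∷ xs@(_ ∷ _)) _ with ∃-≤-average g xs (s≤s z≤n)
  ... | y , y∈xs , g[y]∣xs∣≤Σg with g x ℕP.≤? g y
  ... | yes gx≤gy = x , here refl , ℕP.≤-trans (ℕP.≤-reflexive (ℕP.*-suc (g x) (length xs)))
                      (ℕP.+-monoʳ-≤ (g x) (ℕP.≤-trans (ℕP.*-monoˡ-≤ (length xs) gx≤gy) g[y]∣xs∣≤Σg))
  ... | no gx≰gy = y , there y∈xs , ℕP.≤-trans (ℕP.≤-reflexive (ℕP.*-suc (g y) (length xs)))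
                      (ℕP.+-mono-≤ (ℕP.<⇒≤ (ℕP.≰⇒> gx≰gy)) g[y]∣xs∣≤Σg)

module _ {a b r} {A : Set a} {B : Set b} {R : A → B → Set r} (R? : ∀ x y → Dec (R x y)) where

  sum-count-swap : ∀ xs ys →
    sum (map (λ x → count (R? x) ys) xs) ≡ sum (map (λ y → count (λ x → R? x y) xs) ys)
  sum-count-swap xs [] = sum-zeros xs
    where
    sum-zeros : ∀ xs → sum (map (λ x → count (R? x) []) xs) ≡ 0
    sum-zeros [] = refl
    sum-zeros (_ ∷ xs) = sum-zeros xs
  sum-count-swap xs (y ∷ ys) = trans (split xs) (cong (_+_ (count (λ x → R? x y) xs)) (sum-count-swap xs ys))
    where
    Σ[_] : List B → List A → ℕ
    Σ[ ys ] xs = sum (map (λ x → count (R? x) ys) xs)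
    mutual
      split : ∀ xs → Σ[ y ∷ ys ] xs ≡ count (λ x → R? x y) xs + Σ[ ys ] xs
      split [] = refl
      split (x ∷ xs) with does (R? x y)
      ... | true = cong suc (exchange x xs)
      ... | false = exchange x xs

      exchange : ∀ x xs → count (R? x) ys + Σ[ y ∷ ys ] xs ≡ count (λ x → R? x y) xs + Σ[ ys ] (x ∷ xs)
      exchange x xs = trans (cong (_+_ (count (R? x) ys)) (split xs))
                            (+-exchange (count (R? x) ys) (count (λ x → R? x y) xs) (Σ[ ys ] xs))

0<nCk : ∀ {n k} → k ≤ n → 0 < n C k
0<nCk {k = zero} _ = s≤s z≤n
0<nCk {suc n} {suc k} (s≤s k≤n) =
  subst (0 <_) (nCk+nC[k+1]≡[n+1]C[k+1] n k) (ℕP.<-≤-trans (0<nCk k≤n) (ℕP.m≤m+n (n C k) (n C suc k)))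

C-monoˡ-≤ : ∀ k {m n} → m ≤ n → m C k ≤ n C k
C-monoˡ-≤ zero _ = ℕP.≤-refl
C-monoˡ-≤ (suc k) z≤n = z≤n
C-monoˡ-≤ (suc k) (s≤s {m} {n} m≤n) =
  subst₂ _≤_ (nCk+nC[k+1]≡[n+1]C[k+1] m k) (nCk+nC[k+1]≡[n+1]C[k+1] n k)
    (ℕP.+-mono-≤ (C-monoˡ-≤ k m≤n) (C-monoˡ-≤ (suc k) m≤n))

C-pascal-∸ : ∀ {n k u} → u < k → u < n →
  (n ∸ suc u) C (k ∸ u) + (n ∸ suc u) C (k ∸ suc u) ≡ (n ∸ u) C (k ∸ u)
C-pascal-∸ {n} {k} {u} u<k u<n rewrite ℕP.+-∸-assoc 1 u<k | ℕP.+-∸-assoc 1 u<n =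
  trans (ℕP.+-comm ((n ∸ suc u) C suc (k ∸ suc u)) ((n ∸ suc u) C (k ∸ suc u)))
        (nCk+nC[k+1]≡[n+1]C[k+1] (n ∸ suc u) (k ∸ suc u))

n∸[r∸s]≡n∸r+s : ∀ {n r s} → s ≤ r → r ≤ n → n ∸ (r ∸ s) ≡ n ∸ r + s
n∸[r∸s]≡n∸r+s {n} {r} {s} s≤r r≤n = begin
  n ∸ (r ∸ s)                       ≡⟨ cong (_∸ (r ∸ s)) (sym n∸r+s+[r∸s]≡n) ⟩
  (n ∸ r + s + (r ∸ s)) ∸ (r ∸ s)   ≡⟨ ℕP.m+n∸n≡m (n ∸ r + s) (r ∸ s) ⟩
  n ∸ r + s                         ∎
  where
  open ≡-Reasoning
  n∸r+s+[r∸s]≡n : n ∸ r + s + (r ∸ s) ≡ n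
  n∸r+s+[r∸s]≡n = trans (ℕP.+-assoc (n ∸ r) s (r ∸ s))
                        (trans (cong (_+_ (n ∸ r)) (ℕP.m+[n∸m]≡n s≤r)) (ℕP.m∸n+n≡m r≤n))

x∈p─q⇒x∉q : ∀ {n} (p q : Subset n) {x} → x ∈ p ─ q → x ∉ q
x∈p─q⇒x∉q (_ ∷ p) (true ∷ q) () here
x∈p─q⇒x∉q (_ ∷ p) (false ∷ q) here ()
x∈p─q⇒x∉q (_ ∷ p) (_ ∷ q) (there x∈) (there x∈q) = x∈p─q⇒x∉q p q x∈ x∈q

x∉p-x : ∀ {n} (p : Subset n) x → x ∉ p - x
x∉p-x p x x∈ = x∈p─q⇒x∉q p ⁅ x ⁆ x∈ (x∈⁅x⁆ x)

p-x⊆p : ∀ {n} (p : Subset n) x → p - x ⊆ p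
p-x⊆p p x = p─q⊆p p ⁅ x ⁆

p⊆q∧x∉p⇒p⊆q-x : ∀ {n} {p q : Subset n} {x} → p ⊆ q → x ∉ p → p ⊆ q - x
p⊆q∧x∉p⇒p⊆q-x p⊆q x∉p y∈p = x∈p∧x≢y⇒x∈p-y (p⊆q y∈p) (λ { refl → x∉p y∈p })

∪-lub : ∀ {n} {p q r : Subset n} → p ⊆ r → q ⊆ r → p ∪ q ⊆ r
∪-lub {p = p} {q} p⊆r q⊆r x∈ with x∈p∪q⁻ p q x∈
... | inj₁ x∈p = p⊆r x∈p
... | inj₂ x∈q = q⊆r x∈q

x∈p⇒⁅x⁆⊆p : ∀ {n} {p : Subset n} {x} → x ∈ p → ⁅ x ⁆ ⊆ p
x∈p⇒⁅x⁆⊆p {x = x} x∈p y∈ rewrite x∈⁅y⁆⇒x≡y x y∈ = x∈p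

∣p∣≡0⇒p≡⊥ : ∀ {n} {p : Subset n} → ∣ p ∣ ≡ 0 → p ≡ ⊥
∣p∣≡0⇒p≡⊥ {p = []} _ = refl
∣p∣≡0⇒p≡⊥ {p = false ∷ p} ∣p∣≡0 = cong (false ∷_) (∣p∣≡0⇒p≡⊥ ∣p∣≡0)

x∉p⇒∣p∪⁅x⁆∣≡1+∣p∣ : ∀ {n} (p : Subset n) x → x ∉ p → ∣ p ∪ ⁅ x ⁆ ∣ ≡ suc ∣ p ∣
x∉p⇒∣p∪⁅x⁆∣≡1+∣p∣ (true ∷ p) zero x∉p = contradiction here x∉p
x∉p⇒∣p∪⁅x⁆∣≡1+∣p∣ (false ∷ p) zero _ = cong (suc ∘ ∣_∣) (∪-identityʳ p)
x∉p⇒∣p∪⁅x⁆∣≡1+∣p∣ (false ∷ p) (suc x) x∉p = x∉p⇒∣p∪⁅x⁆∣≡1+∣p∣ p x (x∉p ∘ there)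
x∉p⇒∣p∪⁅x⁆∣≡1+∣p∣ (true ∷ p) (suc x) x∉p = cong suc (x∉p⇒∣p∪⁅x⁆∣≡1+∣p∣ p x (x∉p ∘ there))

x∈p⇒1+∣p-x∣≡∣p∣ : ∀ {n} (p : Subset n) x → x ∈ p → suc ∣ p - x ∣ ≡ ∣ p ∣
x∈p⇒1+∣p-x∣≡∣p∣ (true ∷ p) zero here = cong (suc ∘ ∣_∣) (p─⊥≡p p)
x∈p⇒1+∣p-x∣≡∣p∣ (false ∷ p) (suc x) (there x∈p) = x∈p⇒1+∣p-x∣≡∣p∣ p x x∈p
x∈p⇒1+∣p-x∣≡∣p∣ (true ∷ p) (suc x) (there x∈p) = cong suc (x∈p⇒1+∣p-x∣≡∣p∣ p x x∈p)

2+∣p-x-y∣≡∣p∣ : ∀ {n} (p : Subset n) {x y} → x ∈ p → y ∈ p → x ≢ y → suc (suc ∣ p - x - y ∣) ≡ ∣ p ∣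
2+∣p-x-y∣≡∣p∣ p {x} {y} x∈p y∈p x≢y =
  trans (cong suc (x∈p⇒1+∣p-x∣≡∣p∣ (p - x) y (x∈p∧x≢y⇒x∈p-y y∈p (x≢y ∘ sym)))) (x∈p⇒1+∣p-x∣≡∣p∣ p x x∈p)

∣p∩q∣+∣p∪q∣≡∣p∣+∣q∣ : ∀ {n} (p q : Subset n) → ∣ p ∩ q ∣ + ∣ p ∪ q ∣ ≡ ∣ p ∣ + ∣ q ∣
∣p∩q∣+∣p∪q∣≡∣p∣+∣q∣ [] [] = refl
∣p∩q∣+∣p∪q∣≡∣p∣+∣q∣ (false ∷ p) (false ∷ q) = ∣p∩q∣+∣p∪q∣≡∣p∣+∣q∣ p q
∣p∩q∣+∣p∪q∣≡∣p∣+∣q∣ (false ∷ p) (true ∷ q) =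
  trans (ℕP.+-suc _ _) (trans (cong suc (∣p∩q∣+∣p∪q∣≡∣p∣+∣q∣ p q)) (sym (ℕP.+-suc _ _)))
∣p∩q∣+∣p∪q∣≡∣p∣+∣q∣ (true ∷ p) (false ∷ q) = trans (ℕP.+-suc _ _) (cong suc (∣p∩q∣+∣p∪q∣≡∣p∣+∣q∣ p q))
∣p∩q∣+∣p∪q∣≡∣p∣+∣q∣ (true ∷ p) (true ∷ q) =
  cong suc (trans (ℕP.+-suc _ _) (trans (cong suc (∣p∩q∣+∣p∪q∣≡∣p∣+∣q∣ p q)) (sym (ℕP.+-suc _ _))))

∣p∪q∣≤∣p∣+∣q∣ : ∀ {n} (p q : Subset n) → ∣ p ∪ q ∣ ≤ ∣ p ∣ + ∣ q ∣
∣p∪q∣≤∣p∣+∣q∣ p q = ℕP.≤-trans (ℕP.m≤n+m ∣ p ∪ q ∣ ∣ p ∩ q ∣) (ℕP.≤-reflexive (∣p∩q∣+∣p∪q∣≡∣p∣+∣q∣ p q))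

r∸s≤∣p∩q∣ : ∀ {n r s} (p q : Subset n) → s ≤ r → ∣ p ∣ ≡ r → ∣ q ∣ ≡ r → ∣ p ∪ q ∣ ≤ r + s →
  r ∸ s ≤ ∣ p ∩ q ∣
r∸s≤∣p∩q∣ {r = r} {s} p q s≤r ∣p∣≡r ∣q∣≡r ∣p∪q∣≤r+s = ℕP.+-cancelʳ-≤ (r + s) (r ∸ s) ∣ p ∩ q ∣ (begin
  r ∸ s + (r + s)          ≡⟨ cong (_+_ (r ∸ s)) (ℕP.+-comm r s) ⟩
  r ∸ s + (s + r)          ≡⟨ sym (ℕP.+-assoc (r ∸ s) s r) ⟩
  r ∸ s + s + r            ≡⟨ cong (_+ r) (ℕP.m∸n+n≡m s≤r) ⟩
  r + r                    ≡⟨ sym (trans (∣p∩q∣+∣p∪q∣≡∣p∣+∣q∣ p q) (cong₂ _+_ ∣p∣≡r ∣q∣≡r)) ⟩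
  ∣ p ∩ q ∣ + ∣ p ∪ q ∣    ≤⟨ ℕP.+-monoʳ-≤ ∣ p ∩ q ∣ ∣p∪q∣≤r+s ⟩
  ∣ p ∩ q ∣ + (r + s)      ∎)
  where open ℕP.≤-Reasoning

p⊈q⇒∃∈∉ : ∀ {n} {p q : Subset n} → ¬ (p ⊆ q) → ∃ λ x → x ∈ p × x ∉ q
p⊈q⇒∃∈∉ {p = []} {[]} p⊈q = ⊥-elim (p⊈q λ x∈ → x∈)
p⊈q⇒∃∈∉ {p = true ∷ p} {false ∷ q} _ = zero , here , λ ()
p⊈q⇒∃∈∉ {p = x ∷ p} {y ∷ q} p⊈q with p ⊆? q
p⊈q⇒∃∈∉ {p = false ∷ p} {_ ∷ q} p⊈q | yes p⊆q = ⊥-elim (p⊈q (out⊆ p⊆q))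
p⊈q⇒∃∈∉ {p = true ∷ p} {true ∷ q} p⊈q | yes p⊆q = ⊥-elim (p⊈q (in⊆in p⊆q))
p⊈q⇒∃∈∉ {p = true ∷ p} {false ∷ q} _ | yes _ = zero , here , λ ()
... | no p⊈q′ with p⊈q⇒∃∈∉ p⊈q′
... | x , x∈p , x∉q = suc x , there x∈p , x∉q ∘ drop-there

∣p∣<∣q∣⇒∃∈∉ : ∀ {n} {p q : Subset n} → ∣ p ∣ < ∣ q ∣ → ∃ λ x → x ∈ q × x ∉ p
∣p∣<∣q∣⇒∃∈∉ ∣p∣<∣q∣ = p⊈q⇒∃∈∉ (λ q⊆p → ℕP.<⇒≱ ∣p∣<∣q∣ (p⊆q⇒∣p∣≤∣q∣ q⊆p))

⊆∧∣≡∣⇒≡ : ∀ {n} {p q : Subset n} → p ⊆ q → ∣ p ∣ ≡ ∣ q ∣ → p ≡ q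
⊆∧∣≡∣⇒≡ {p = p} {q} p⊆q ∣p∣≡∣q∣ with q ⊆? p
... | yes q⊆p = ⊆-antisym p⊆q q⊆p
... | no q⊈p with p⊈q⇒∃∈∉ q⊈p
... | x , x∈q , x∉p = contradiction ∣p∣≡∣q∣ (ℕP.<⇒≢ (p⊂q⇒∣p∣<∣q∣ (p⊆q , x , x∈q , x∉p)))

⊆-extend : ∀ {n} (p q : Subset n) k → p ⊆ q → ∣ p ∣ ≤ k → k ≤ ∣ q ∣ → ∃ λ w → p ⊆ w × w ⊆ q × ∣ w ∣ ≡ k
⊆-extend [] [] zero _ _ _ = [] , ⊆-refl , ⊆-refl , refl
⊆-extend (true ∷ p) (false ∷ q) k p⊆q _ _ = contradiction (p⊆q here) λ ()
⊆-extend (false ∷ p) (false ∷ q) k p⊆q ∣p∣≤k k≤∣q∣ with ⊆-extend p q k (drop-∷-⊆ p⊆q) ∣p∣≤k k≤∣q∣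
... | w , p⊆w , w⊆q , ∣w∣≡k = false ∷ w , out⊆ p⊆w , out⊆ w⊆q , ∣w∣≡k
⊆-extend (true ∷ p) (true ∷ q) (suc k) p⊆q (s≤s ∣p∣≤k) (s≤s k≤∣q∣)
  with ⊆-extend p q k (drop-∷-⊆ p⊆q) ∣p∣≤k k≤∣q∣
... | w , p⊆w , w⊆q , ∣w∣≡k = true ∷ w , in⊆in p⊆w , in⊆in w⊆q , cong suc ∣w∣≡k
⊆-extend (false ∷ p) (true ∷ q) k p⊆q ∣p∣≤k k≤1+∣q∣ with k ℕP.≤? ∣ q ∣
... | no k≰∣q∣ = true ∷ q , out⊆ (drop-∷-⊆ p⊆q) , ⊆-refl , ℕP.≤-antisym (ℕP.≰⇒> k≰∣q∣) k≤1+∣q∣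
... | yes k≤∣q∣ with ⊆-extend p q k (drop-∷-⊆ p⊆q) ∣p∣≤k k≤∣q∣
... | w , p⊆w , w⊆q , ∣w∣≡k = false ∷ w , out⊆ p⊆w , out⊆ w⊆q , ∣w∣≡k

leastSingleton : ∀ {n} → Subset n → Subset n
leastSingleton [] = []
leastSingleton (true ∷ p) = true ∷ ⊥
leastSingleton (false ∷ p) = false ∷ leastSingleton p

leastSingleton⊆ : ∀ {n} (p : Subset n) → leastSingleton p ⊆ p
leastSingleton⊆ (true ∷ p) here = here
leastSingleton⊆ (true ∷ p) (there x∈⊥) = ⊥-elim (∉⊥ x∈⊥)
leastSingleton⊆ (false ∷ p) (there x∈) = there (leastSingleton⊆ p x∈)

∣leastSingleton∣≤1 : ∀ {n} (p : Subset n) → ∣ leastSingleton p ∣ ≤ 1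
∣leastSingleton∣≤1 [] = z≤n
∣leastSingleton∣≤1 {suc n} (true ∷ p) = s≤s (ℕP.≤-reflexive (∣⊥∣≡0 n))
∣leastSingleton∣≤1 (false ∷ p) = ∣leastSingleton∣≤1 p

leastSingleton-nonempty : ∀ {n} {p : Subset n} → Nonempty p → Nonempty (leastSingleton p)
leastSingleton-nonempty {p = true ∷ p} _ = zero , here
leastSingleton-nonempty {p = false ∷ p} (suc x , there x∈p) with leastSingleton-nonempty (x , x∈p)
... | y , y∈ = suc y , there y∈

⊆⋃ : ∀ {n} {p : Subset n} {ps} → p ∈ₗ ps → p ⊆ ⋃ ps
⊆⋃ {ps = p ∷ ps} (here refl) = p⊆p∪q (⋃ ps)
⊆⋃ {ps = p ∷ ps} (there p∈ps) = q⊆p∪q p (⋃ ps) ∘ ⊆⋃ p∈ps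

∉⋃ : ∀ {n} {x : Fin n} ps → (∀ p → p ∈ₗ ps → x ∉ p) → x ∉ ⋃ ps
∉⋃ [] _ = ∉⊥
∉⋃ (p ∷ ps) x∉ps x∈ with x∈p∪q⁻ p (⋃ ps) x∈
... | inj₁ x∈p = x∉ps p (here refl) x∈p
... | inj₂ x∈⋃ = ∉⋃ ps (λ q q∈ → x∉ps q (there q∈)) x∈⋃

∣⋃∣≤sum : ∀ {n} (ps : List (Subset n)) → ∣ ⋃ ps ∣ ≤ sum (map ∣_∣ ps)
∣⋃∣≤sum {n} [] = ℕP.≤-reflexive (∣⊥∣≡0 n)
∣⋃∣≤sum (p ∷ ps) = ℕP.≤-trans (∣p∪q∣≤∣p∣+∣q∣ p (⋃ ps)) (ℕP.+-monoʳ-≤ ∣ p ∣ (∣⋃∣≤sum ps))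

-- Sums over the k-subsets of a set

-- subsetSum k e f = Σ { f T ∣ T ⊆ e , ∣ T ∣ ≡ k }
subsetSum : ∀ {n} → ℕ → Subset n → (Subset n → ℚ) → ℚ
subsetSum k (false ∷ e) f = subsetSum k e (f ∘ (false ∷_))
subsetSum zero [] f = f []
subsetSum (suc k) [] f = 0ℚ
subsetSum zero (true ∷ e) f = subsetSum zero e (f ∘ (false ∷_))
subsetSum (suc k) (true ∷ e) f = subsetSum (suc k) e (f ∘ (false ∷_)) ℚ.+ subsetSum k e (f ∘ (true ∷_))

subsetSum-cong : ∀ {n} k (e : Subset n) {f g : Subset n → ℚ} →
  (∀ T → T ⊆ e → ∣ T ∣ ≡ k → f T ≡ g T) → subsetSum k e f ≡ subsetSum k e g
subsetSum-cong zero [] f≗g = f≗g [] (λ ()) refl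
subsetSum-cong (suc k) [] f≗g = refl
subsetSum-cong k (false ∷ e) f≗g = subsetSum-cong k e λ T T⊆e → f≗g (false ∷ T) (out⊆ T⊆e)
subsetSum-cong zero (true ∷ e) f≗g = subsetSum-cong zero e λ T T⊆e → f≗g (false ∷ T) (out⊆ T⊆e)
subsetSum-cong (suc k) (true ∷ e) f≗g = cong₂ ℚ._+_
  (subsetSum-cong (suc k) e λ T T⊆e → f≗g (false ∷ T) (out⊆ T⊆e))
  (subsetSum-cong k e λ T T⊆e ∣T∣≡k → f≗g (true ∷ T) (in⊆in T⊆e) (cong suc ∣T∣≡k))

subsetSum-- : ∀ {n} k (e : Subset n) (f g : Subset n → ℚ) →
  subsetSum k e (λ T → f T ℚ.- g T) ≡ subsetSum k e f ℚ.- subsetSum k e g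
subsetSum-- zero [] f g = refl
subsetSum-- (suc k) [] f g = refl
subsetSum-- k (false ∷ e) f g = subsetSum-- k e (f ∘ (false ∷_)) (g ∘ (false ∷_))
subsetSum-- zero (true ∷ e) f g = subsetSum-- zero e (f ∘ (false ∷_)) (g ∘ (false ∷_))
subsetSum-- (suc k) (true ∷ e) f g = trans
  (cong₂ ℚ._+_ (subsetSum-- (suc k) e f₀ g₀) (subsetSum-- k e f₁ g₁))
  (interchange (subsetSum (suc k) e f₀) (subsetSum (suc k) e g₀) (subsetSum k e f₁) (subsetSum k e g₁))
  where
  f₀ f₁ g₀ g₁ : Subset _ → ℚ
  f₀ = f ∘ (false ∷_)
  f₁ = f ∘ (true ∷_)
  g₀ = g ∘ (false ∷_)
  g₁ = g ∘ (true ∷_)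
  interchange : ∀ a b c d → (a ℚ.- b) ℚ.+ (c ℚ.- d) ≡ (a ℚ.+ c) ℚ.- (b ℚ.+ d)
  interchange = solve 4 (λ a b c d → (a :- b) :+ (c :- d) := (a :+ c) :- (b :+ d)) refl

subsetSum-zero : ∀ {n} (e : Subset n) (f : Subset n → ℚ) → subsetSum 0 e f ≡ f ⊥
subsetSum-zero [] f = refl
subsetSum-zero (false ∷ e) f = subsetSum-zero e (f ∘ (false ∷_))
subsetSum-zero (true ∷ e) f = subsetSum-zero e (f ∘ (false ∷_))

subsetSum-insert : ∀ {n} k (e : Subset n) x (f : Subset n → ℚ) → x ∉ e →
  subsetSum (suc k) (e ∪ ⁅ x ⁆) f ≡ subsetSum (suc k) e f ℚ.+ subsetSum k e (f ∘ (_∪ ⁅ x ⁆))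
subsetSum-insert k (true ∷ e) zero f x∉e = contradiction here x∉e
subsetSum-insert k (false ∷ e) zero f _ rewrite ∪-identityʳ e =
  cong (subsetSum (suc k) e (f ∘ (false ∷_)) ℚ.+_)
       (subsetSum-cong k e λ T _ _ → cong (f ∘ (true ∷_)) (sym (∪-identityʳ T)))
subsetSum-insert k (false ∷ e) (suc x) f x∉e = subsetSum-insert k e x (f ∘ (false ∷_)) (x∉e ∘ there)
subsetSum-insert zero (true ∷ e) (suc x) f x∉e = begin
  subsetSum 1 (e ∪ ⁅ x ⁆) f₀ ℚ.+ subsetSum 0 (e ∪ ⁅ x ⁆) f₁
    ≡⟨ cong₂ ℚ._+_ (subsetSum-insert zero e x f₀ (x∉e ∘ there))
                   (trans (subsetSum-zero (e ∪ ⁅ x ⁆) f₁) (sym (subsetSum-zero e f₁))) ⟩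
  (subsetSum 1 e f₀ ℚ.+ subsetSum 0 e (f₀ ∘ (_∪ ⁅ x ⁆))) ℚ.+ subsetSum 0 e f₁
    ≡⟨ ℚ-xy∙z≈xz∙y (subsetSum 1 e f₀) (subsetSum 0 e (f₀ ∘ (_∪ ⁅ x ⁆))) (subsetSum 0 e f₁) ⟩
  (subsetSum 1 e f₀ ℚ.+ subsetSum 0 e f₁) ℚ.+ subsetSum 0 e (f₀ ∘ (_∪ ⁅ x ⁆)) ∎
  where
  open ≡-Reasoning
  f₀ f₁ : Subset _ → ℚ
  f₀ = f ∘ (false ∷_)
  f₁ = f ∘ (true ∷_)
subsetSum-insert (suc k) (true ∷ e) (suc x) f x∉e = trans
  (cong₂ ℚ._+_ (subsetSum-insert (suc k) e x f₀ (x∉e ∘ there)) (subsetSum-insert k e x f₁ (x∉e ∘ there)))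
  (ℚ-interchange (subsetSum (suc (suc k)) e f₀) (subsetSum (suc k) e (f₀ ∘ (_∪ ⁅ x ⁆)))
                 (subsetSum (suc k) e f₁) (subsetSum k e (f₁ ∘ (_∪ ⁅ x ⁆))))
  where
  f₀ f₁ : Subset _ → ℚ
  f₀ = f ∘ (false ∷_)
  f₁ = f ∘ (true ∷_)

subsetSum-swap : ∀ {n} k (g : Subset n) (α : Subset n → ℚ) {y z} → y ∉ g → z ∉ g →
  subsetSum k g (λ T → α (T ∪ ⁅ z ⁆) ℚ.- α (T ∪ ⁅ y ⁆))
    ≡ subsetSum (suc k) (g ∪ ⁅ z ⁆) α ℚ.- subsetSum (suc k) (g ∪ ⁅ y ⁆) α
subsetSum-swap k g α {y} {z} y∉g z∉g = begin
  subsetSum k g (λ T → α (T ∪ ⁅ z ⁆) ℚ.- α (T ∪ ⁅ y ⁆))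
    ≡⟨ subsetSum-- k g (α ∘ (_∪ ⁅ z ⁆)) (α ∘ (_∪ ⁅ y ⁆)) ⟩
  Σz ℚ.- Σy
    ≡⟨ cancel (subsetSum (suc k) g α) Σz Σy ⟩
  (subsetSum (suc k) g α ℚ.+ Σz) ℚ.- (subsetSum (suc k) g α ℚ.+ Σy)
    ≡⟨ sym (cong₂ ℚ._-_ (subsetSum-insert k g z α z∉g) (subsetSum-insert k g y α y∉g)) ⟩
  subsetSum (suc k) (g ∪ ⁅ z ⁆) α ℚ.- subsetSum (suc k) (g ∪ ⁅ y ⁆) α ∎
  where
  open ≡-Reasoning
  Σz = subsetSum k g (α ∘ (_∪ ⁅ z ⁆))
  Σy = subsetSum k g (α ∘ (_∪ ⁅ y ⁆))
  cancel : ∀ a b c → b ℚ.- c ≡ (a ℚ.+ b) ℚ.- (a ℚ.+ c)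
  cancel = solve 3 (λ a b c → b :- c := (a :+ b) :- (a :+ c)) refl

subsetSum-const : ∀ {n} k (e : Subset n) {f : Subset n → ℚ} {a} →
  (∀ T → T ⊆ e → ∣ T ∣ ≡ k → f T ≡ a) → subsetSum k e f ≡ (∣ e ∣ C k) · a
subsetSum-const k (false ∷ e) f≗a = subsetSum-const k e λ T T⊆e → f≗a (false ∷ T) (out⊆ T⊆e)
subsetSum-const zero [] {a = a} f≗a = trans (f≗a [] (λ ()) refl) (sym (ℚP.+-identityʳ a))
subsetSum-const (suc k) [] f≗a = refl
subsetSum-const zero (true ∷ e) f≗a = subsetSum-const zero e λ T T⊆e → f≗a (false ∷ T) (out⊆ T⊆e)
subsetSum-const (suc k) (true ∷ e) {f} {a} f≗a = begin
  subsetSum (suc k) e (f ∘ (false ∷_)) ℚ.+ subsetSum k e (f ∘ (true ∷_))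
    ≡⟨ cong₂ ℚ._+_ (subsetSum-const (suc k) e λ T T⊆e → f≗a (false ∷ T) (out⊆ T⊆e))
                   (subsetSum-const k e λ T T⊆e ∣T∣≡k → f≗a (true ∷ T) (in⊆in T⊆e) (cong suc ∣T∣≡k)) ⟩
  (∣ e ∣ C suc k) · a ℚ.+ (∣ e ∣ C k) · a
    ≡⟨ sym (×-homo-+ a (∣ e ∣ C suc k) (∣ e ∣ C k)) ⟩
  (∣ e ∣ C suc k + ∣ e ∣ C k) · a
    ≡⟨ cong (_· a) (trans (ℕP.+-comm (∣ e ∣ C suc k) (∣ e ∣ C k)) (nCk+nC[k+1]≡[n+1]C[k+1] ∣ e ∣ k)) ⟩
  (suc ∣ e ∣ C suc k) · a ∎
  where open ≡-Reasoning

m·a≡0⇒a≡0 : ∀ {m} a → 0 < m → m · a ≡ 0ℚ → a ≡ 0ℚ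
m·a≡0⇒a≡0 {suc m} a _ 1+m·a≡0 with ℚP.<-cmp a 0ℚ
... | tri≈ _ a≡0 _ = a≡0
... | tri< a<0 _ _ = contradiction 1+m·a≡0 (ℚP.<⇒≢ (subst (a ℚ.+ m · a ℚ.<_) (ℚP.+-identityˡ 0ℚ)
                       (ℚP.+-mono-<-≤ a<0 (·-nonpos m (ℚP.<⇒≤ a<0)))))
  where
  ·-nonpos : ∀ m → a ℚ.≤ 0ℚ → m · a ℚ.≤ 0ℚ
  ·-nonpos zero _ = ℚP.≤-refl
  ·-nonpos (suc m) a≤0 = subst (a ℚ.+ m · a ℚ.≤_) (ℚP.+-identityˡ 0ℚ) (ℚP.+-mono-≤ a≤0 (·-nonpos m a≤0))
... | tri> _ _ 0<a = contradiction (sym 1+m·a≡0) (ℚP.<⇒≢ (subst (ℚ._< a ℚ.+ m · a) (ℚP.+-identityˡ 0ℚ)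
                       (ℚP.+-mono-<-≤ 0<a (·-nonneg m (ℚP.<⇒≤ 0<a)))))
  where
  ·-nonneg : ∀ m → 0ℚ ℚ.≤ a → 0ℚ ℚ.≤ m · a
  ·-nonneg zero _ = ℚP.≤-refl
  ·-nonneg (suc m) 0≤a = subst (ℚ._≤ a ℚ.+ m · a) (ℚP.+-identityˡ 0ℚ) (ℚP.+-mono-≤ 0≤a (·-nonneg m 0≤a))

kSets-zero : ∀ n → kSets (suc n) 0 ≡ map (false ∷_) (kSets n 0)
kSets-zero n = begin
  filter P? (map (false ∷_) A ++ map (true ∷_) A)
    ≡⟨ ListP.filter-++ P? (map (false ∷_) A) (map (true ∷_) A) ⟩
  filter P? (map (false ∷_) A) ++ filter P? (map (true ∷_) A)
    ≡⟨ cong₂ _++_ (filter-map P? (false ∷_) A) (trans (filter-map P? (true ∷_) A) (cong (map (true ∷_)) none)) ⟩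
  map (false ∷_) (kSets n 0) ++ []
    ≡⟨ ListP.++-identityʳ _ ⟩
  map (false ∷_) (kSets n 0) ∎
  where
  open ≡-Reasoning
  A = allSubsets n
  P? = λ (S : Subset (suc n)) → ∣ S ∣ ℕ.≟ 0
  none : filter (P? ∘ (true ∷_)) A ≡ []
  none = ListP.filter-none (P? ∘ (true ∷_)) (All.universal (λ _ ()) A)

kSets-suc : ∀ n k → kSets (suc n) (suc k) ≡ map (false ∷_) (kSets n (suc k)) ++ map (true ∷_) (kSets n k)
kSets-suc n k = begin
  filter P? (map (false ∷_) A ++ map (true ∷_) A)
    ≡⟨ ListP.filter-++ P? (map (false ∷_) A) (map (true ∷_) A) ⟩
  filter P? (map (false ∷_) A) ++ filter P? (map (true ∷_) A)
    ≡⟨ cong₂ _++_ (filter-map P? (false ∷_) A) (filter-map P? (true ∷_) A) ⟩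
  map (false ∷_) (kSets n (suc k)) ++ map (true ∷_) (filter (P? ∘ (true ∷_)) A)
    ≡⟨ cong (λ xs → map (false ∷_) (kSets n (suc k)) ++ map (true ∷_) xs)
            (ListP.filter-≐ (P? ∘ (true ∷_)) (λ S → ∣ S ∣ ℕ.≟ k) (ℕP.suc-injective , cong suc) A) ⟩
  map (false ∷_) (kSets n (suc k)) ++ map (true ∷_) (kSets n k) ∎
  where
  open ≡-Reasoning
  A = allSubsets n
  P? = λ (S : Subset (suc n)) → ∣ S ∣ ℕ.≟ suc k

∈-kSets⁻ : ∀ {n k e} → e ∈ₗ kSets n k → ∣ e ∣ ≡ k
∈-kSets⁻ {n} {k} e∈ = proj₂ (∈-filter⁻ (λ S → ∣ S ∣ ℕ.≟ k) {xs = allSubsets n} e∈)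

length-kSets : ∀ n k → length (kSets n k) ≡ n C k
length-kSets zero zero = refl
length-kSets zero (suc k) = refl
length-kSets (suc n) zero =
  trans (cong length (kSets-zero n)) (trans (ListP.length-map (false ∷_) (kSets n 0)) (length-kSets n 0))
length-kSets (suc n) (suc k) = begin
  length (kSets (suc n) (suc k))
    ≡⟨ cong length (kSets-suc n k) ⟩
  length (map (false ∷_) (kSets n (suc k)) ++ map (true ∷_) (kSets n k))
    ≡⟨ ListP.length-++ (map (false ∷_) (kSets n (suc k))) ⟩
  length (map (false ∷_) (kSets n (suc k))) + length (map (true ∷_) (kSets n k))
    ≡⟨ cong₂ _+_ (ListP.length-map (false ∷_) (kSets n (suc k))) (ListP.length-map (true ∷_) (kSets n k)) ⟩
  length (kSets n (suc k)) + length (kSets n k)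
    ≡⟨ cong₂ _+_ (length-kSets n (suc k)) (length-kSets n k) ⟩
  n C suc k + n C k
    ≡⟨ trans (ℕP.+-comm (n C suc k) (n C k)) (nCk+nC[k+1]≡[n+1]C[k+1] n k) ⟩
  suc n C suc k ∎
  where open ≡-Reasoning

allSubsets-unique : ∀ n → Unique (allSubsets n)
allSubsets-unique zero = All.[] AllPairs.∷ AllPairs.[]
allSubsets-unique (suc n) = UniqueP.++⁺ (UniqueP.map⁺ VecP.∷-injectiveʳ (allSubsets-unique n))
  (UniqueP.map⁺ VecP.∷-injectiveʳ (allSubsets-unique n)) disjoint
  where
  disjoint : ∀ {S} → S ∈ₗ map (false ∷_) (allSubsets n) × S ∈ₗ map (true ∷_) (allSubsets n) → Empty
  disjoint (S∈₀ , S∈₁) with ∈-map⁻ (false ∷_) S∈₀ | ∈-map⁻ (true ∷_) S∈₁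
  ... | _ , _ , refl | _ , _ , ()

kSets-unique : ∀ n k → Unique (kSets n k)
kSets-unique n k = UniqueP.filter⁺ (λ S → ∣ S ∣ ℕ.≟ k) (allSubsets-unique n)

count-kSets-suc : ∀ {n p} {P : Pred (Subset (suc n)) p} (P? : Decidable P) k →
  count P? (kSets (suc n) (suc k))
    ≡ count (P? ∘ (false ∷_)) (kSets n (suc k)) + count (P? ∘ (true ∷_)) (kSets n k)
count-kSets-suc {n} P? k = begin
  length (filter P? (kSets (suc n) (suc k)))
    ≡⟨ cong (length ∘ filter P?) (kSets-suc n k) ⟩
  length (filter P? (map (false ∷_) K₁ ++ map (true ∷_) K₀))
    ≡⟨ cong length (ListP.filter-++ P? (map (false ∷_) K₁) (map (true ∷_) K₀)) ⟩
  length (filter P? (map (false ∷_) K₁) ++ filter P? (map (true ∷_) K₀))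
    ≡⟨ ListP.length-++ (filter P? (map (false ∷_) K₁)) ⟩
  length (filter P? (map (false ∷_) K₁)) + length (filter P? (map (true ∷_) K₀))
    ≡⟨ cong₂ _+_ (trans (cong length (filter-map P? (false ∷_) K₁))
                        (ListP.length-map (false ∷_) (filter (P? ∘ (false ∷_)) K₁)))
                 (trans (cong length (filter-map P? (true ∷_) K₀))
                        (ListP.length-map (true ∷_) (filter (P? ∘ (true ∷_)) K₀))) ⟩
  count (P? ∘ (false ∷_)) K₁ + count (P? ∘ (true ∷_)) K₀ ∎
  where
  open ≡-Reasoning
  K₁ = kSets n (suc k)
  K₀ = kSets n k

module _ {a} {A : Set a} where

  sumℚ-map-++ : (f : A → ℚ) (xs ys : List A) → sumℚ (map f (xs ++ ys)) ≡ sumℚ (map f xs) ℚ.+ sumℚ (map f ys)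
  sumℚ-map-++ f [] ys = sym (ℚP.+-identityˡ _)
  sumℚ-map-++ f (x ∷ xs) ys = trans (cong (f x ℚ.+_) (sumℚ-map-++ f xs ys)) (sym (ℚP.+-assoc (f x) _ _))

  sumℚ-map-zero : {f : A → ℚ} → (∀ x → f x ≡ 0ℚ) → ∀ xs → sumℚ (map f xs) ≡ 0ℚ
  sumℚ-map-zero f≗0 [] = refl
  sumℚ-map-zero f≗0 (x ∷ xs) = trans (cong₂ ℚ._+_ (f≗0 x) (sumℚ-map-zero f≗0 xs)) (ℚP.+-identityˡ 0ℚ)

c-yes : ∀ {n} {S e : Subset n} → S ⊆ e → c S e ≡ ℚ.1ℚ
c-yes {S = S} {e} S⊆e with S ⊆? e
... | yes _ = refl
... | no S⊈e = ⊥-elim (S⊈e S⊆e)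

c-no : ∀ {n} {S e : Subset n} → ¬ (S ⊆ e) → c S e ≡ 0ℚ
c-no {S = S} {e} S⊈e with S ⊆? e
... | yes S⊆e = ⊥-elim (S⊈e S⊆e)
... | no _ = refl

c-resp-⇔ : ∀ {m n} {S e : Subset m} {S′ e′ : Subset n} →
  (S ⊆ e → S′ ⊆ e′) → (S′ ⊆ e′ → S ⊆ e) → c S e ≡ c S′ e′
c-resp-⇔ {S = S} {e} {S′} {e′} to from = by-cases (S ⊆? e)
  where
  by-cases : Dec (S ⊆ e) → c S e ≡ c S′ e′
  by-cases (yes S⊆e) = trans (c-yes S⊆e) (sym (c-yes (to S⊆e)))
  by-cases (no S⊈e) = trans (c-no S⊈e) (sym (c-no (S⊈e ∘ from)))

Σ-map-∷ : ∀ {n} (α : Subset (suc n) → ℚ) {x b} {e : Subset n} → (∀ {T} → T ⊆ e → x ∷ T ⊆ b ∷ e) → ∀ K →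
  sumℚ (map (λ S → α S ℚ.* c S (b ∷ e)) (map (x ∷_) K)) ≡ sumℚ (map (λ T → α (x ∷ T) ℚ.* c T e) K)
Σ-map-∷ α {x} lift K = trans (cong sumℚ (sym (ListP.map-∘ K)))
  (cong sumℚ (ListP.map-cong (λ T → cong (α (x ∷ T) ℚ.*_) (c-resp-⇔ drop-∷-⊆ lift)) K))

Σ-kSets≡subsetSum : ∀ n k (e : Subset n) (α : Subset n → ℚ) →
  sumℚ (map (λ S → α S ℚ.* c S e) (kSets n k)) ≡ subsetSum k e α
Σ-kSets≡subsetSum zero zero [] α = trans (cong (λ x → α [] ℚ.* x ℚ.+ 0ℚ) (c-yes {S = []} {[]} λ ()))
                                        (trans (ℚP.+-identityʳ _) (ℚP.*-identityʳ _))
Σ-kSets≡subsetSum zero (suc k) [] α = refl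
Σ-kSets≡subsetSum (suc n) zero (b ∷ e) α = begin
  sumℚ (map f (kSets (suc n) 0))                          ≡⟨ cong (sumℚ ∘ map f) (kSets-zero n) ⟩
  sumℚ (map f (map (false ∷_) (kSets n 0)))               ≡⟨ Σ-map-∷ α out⊆ (kSets n 0) ⟩
  sumℚ (map (λ T → α (false ∷ T) ℚ.* c T e) (kSets n 0))  ≡⟨ Σ-kSets≡subsetSum n 0 e (α ∘ (false ∷_)) ⟩
  subsetSum 0 e (α ∘ (false ∷_))                          ≡⟨ subsetSum-zero e _ ⟩
  α ⊥                                                     ≡⟨ sym (subsetSum-zero (b ∷ e) α) ⟩
  subsetSum 0 (b ∷ e) α                                   ∎
  where
  open ≡-Reasoning
  f = λ S → α S ℚ.* c S (b ∷ e)
Σ-kSets≡subsetSum (suc n) (suc k) (b ∷ e) α = begin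
  sumℚ (map f (kSets (suc n) (suc k)))
    ≡⟨ cong (sumℚ ∘ map f) (kSets-suc n k) ⟩
  sumℚ (map f (map (false ∷_) (kSets n (suc k)) ++ map (true ∷_) (kSets n k)))
    ≡⟨ sumℚ-map-++ f (map (false ∷_) (kSets n (suc k))) (map (true ∷_) (kSets n k)) ⟩
  sumℚ (map f (map (false ∷_) (kSets n (suc k)))) ℚ.+ Σtrue b
    ≡⟨ cong (ℚ._+ Σtrue b)
            (trans (Σ-map-∷ α out⊆ (kSets n (suc k))) (Σ-kSets≡subsetSum n (suc k) e (α ∘ (false ∷_)))) ⟩
  subsetSum (suc k) e (α ∘ (false ∷_)) ℚ.+ Σtrue b
    ≡⟨ withTrue b ⟩
  subsetSum (suc k) (b ∷ e) α ∎
  where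
  open ≡-Reasoning
  f = λ S → α S ℚ.* c S (b ∷ e)
  Σtrue : ∀ b → ℚ
  Σtrue b = sumℚ (map (λ S → α S ℚ.* c S (b ∷ e)) (map (true ∷_) (kSets n k)))
  withTrue : ∀ b → subsetSum (suc k) e (α ∘ (false ∷_)) ℚ.+ Σtrue b ≡ subsetSum (suc k) (b ∷ e) α
  withTrue false = trans (cong (subsetSum (suc k) e (α ∘ (false ∷_)) ℚ.+_) Σtrue≡0) (ℚP.+-identityʳ _)
    where
    c≡0 : ∀ T → c (true ∷ T) (false ∷ e) ≡ 0ℚ
    c≡0 T = c-no {S = true ∷ T} {false ∷ e} λ sub → contradiction (sub here) λ ()
    Σtrue≡0 : Σtrue false ≡ 0ℚ
    Σtrue≡0 = trans (cong sumℚ (sym (ListP.map-∘ (kSets n k))))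
      (sumℚ-map-zero (λ T → trans (cong (α (true ∷ T) ℚ.*_) (c≡0 T)) (ℚP.*-zeroʳ (α (true ∷ T)))) (kSets n k))
  withTrue true = cong (subsetSum (suc k) e (α ∘ (false ∷_)) ℚ.+_)
    (trans (Σ-map-∷ α in⊆in (kSets n k)) (Σ-kSets≡subsetSum n k e (α ∘ (true ∷_))))

-- The Gottlieb–Kantor theorem

SwapInvariant : ∀ {n} → ℕ → Subset n → (Subset n → ℚ) → Set
SwapInvariant {n} k W φ = ∀ (y z : Fin n) → y ∈ W → z ∈ W → y ≢ z →
  ∀ U → U ⊆ W → y ∉ U → z ∉ U → ∣ U ∣ ≡ k → φ (U ∪ ⁅ z ⁆) ≡ φ (U ∪ ⁅ y ⁆)

swapInvariant-false∷ : ∀ {n} k b (W : Subset n) φ → SwapInvariant k (b ∷ W) φ →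
  SwapInvariant k W (φ ∘ (false ∷_))
swapInvariant-false∷ k b W φ inv y z y∈W z∈W y≢z U U⊆W y∉U z∉U =
  inv (suc y) (suc z) (there y∈W) (there z∈W) (y≢z ∘ FinP.suc-injective)
      (false ∷ U) (out⊆ U⊆W) (y∉U ∘ drop-there) (z∉U ∘ drop-there)

swapInvariant-true∷ : ∀ {n} k (W : Subset n) φ → SwapInvariant (suc k) (true ∷ W) φ →
  SwapInvariant k W (φ ∘ (true ∷_))
swapInvariant-true∷ k W φ inv y z y∈W z∈W y≢z U U⊆W y∉U z∉U ∣U∣≡k =
  inv (suc y) (suc z) (there y∈W) (there z∈W) (y≢z ∘ FinP.suc-injective)
      (true ∷ U) (in⊆in U⊆W) (y∉U ∘ drop-there) (z∉U ∘ drop-there) (cong suc ∣U∣≡k)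

-- the (k+1)-subsets of W are connected by single swaps
mutual
  swapInvariant⇒constant : ∀ {n} k (W : Subset n) φ → SwapInvariant k W φ →
    ∀ S T → S ⊆ W → T ⊆ W → ∣ S ∣ ≡ suc k → ∣ T ∣ ≡ suc k → φ S ≡ φ T
  swapInvariant⇒constant k [] φ inv [] [] _ _ _ _ = refl
  swapInvariant⇒constant k (w ∷ W) φ inv (false ∷ S) (false ∷ T) S⊆W T⊆W ∣S∣ ∣T∣ =
    swapInvariant⇒constant k W (φ ∘ (false ∷_)) (swapInvariant-false∷ k w W φ inv)
      S T (drop-∷-⊆ S⊆W) (drop-∷-⊆ T⊆W) ∣S∣ ∣T∣
  swapInvariant⇒constant k (w ∷ W) φ inv (true ∷ S) (true ∷ T) S⊆W T⊆W ∣S∣ ∣T∣ with S⊆W here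
  swapInvariant⇒constant zero (true ∷ W) φ inv (true ∷ S) (true ∷ T) _ _ ∣S∣ ∣T∣ | here =
    cong (φ ∘ (true ∷_)) (trans (∣p∣≡0⇒p≡⊥ (ℕP.suc-injective ∣S∣)) (sym (∣p∣≡0⇒p≡⊥ (ℕP.suc-injective ∣T∣))))
  swapInvariant⇒constant (suc k) (true ∷ W) φ inv (true ∷ S) (true ∷ T) S⊆W T⊆W ∣S∣ ∣T∣ | here =
    swapInvariant⇒constant k W (φ ∘ (true ∷_)) (swapInvariant-true∷ k W φ inv)
      S T (drop-∷-⊆ S⊆W) (drop-∷-⊆ T⊆W) (ℕP.suc-injective ∣S∣) (ℕP.suc-injective ∣T∣)
  swapInvariant⇒constant k (w ∷ W) φ inv (true ∷ S) (false ∷ T) S⊆W T⊆W ∣S∣ ∣T∣ =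
    swapInvariant⇒constant-mixed k w W φ inv S T S⊆W T⊆W ∣S∣ ∣T∣
  swapInvariant⇒constant k (w ∷ W) φ inv (false ∷ S) (true ∷ T) S⊆W T⊆W ∣S∣ ∣T∣ =
    sym (swapInvariant⇒constant-mixed k w W φ inv T S T⊆W S⊆W ∣T∣ ∣S∣)

  -- swap the point 0 of true ∷ S for a point t ∈ T ─ S, after which both sets avoid 0
  swapInvariant⇒constant-mixed : ∀ {n} k w (W : Subset n) φ → SwapInvariant k (w ∷ W) φ →
    ∀ S T → true ∷ S ⊆ w ∷ W → false ∷ T ⊆ w ∷ W → suc ∣ S ∣ ≡ suc k → ∣ T ∣ ≡ suc k →
    φ (true ∷ S) ≡ φ (false ∷ T)
  swapInvariant⇒constant-mixed k w W φ inv S T S⊆W T⊆W ∣S∣ ∣T∣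
    with ∣p∣<∣q∣⇒∃∈∉ {p = S} {T} (ℕP.≤-reflexive (trans ∣S∣ (sym ∣T∣)))
  ... | t , t∈T , t∉S = begin
    φ (true ∷ S)                ≡⟨ cong (φ ∘ (true ∷_)) (sym (∪-identityʳ S)) ⟩
    φ ((false ∷ S) ∪ ⁅ zero ⁆)  ≡⟨ inv (suc t) zero (T⊆W (there t∈T)) (S⊆W here) (λ ()) (false ∷ S)
                                       (out⊆ (drop-∷-⊆ S⊆W)) (t∉S ∘ drop-there) (λ ()) (ℕP.suc-injective ∣S∣) ⟩
    φ (false ∷ (S ∪ ⁅ t ⁆))     ≡⟨ swapInvariant⇒constant k W (φ ∘ (false ∷_)) (swapInvariant-false∷ k w W φ inv)
                                       (S ∪ ⁅ t ⁆) T S∪t⊆W (drop-∷-⊆ T⊆W)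
                                       (trans (x∉p⇒∣p∪⁅x⁆∣≡1+∣p∣ S t t∉S) ∣S∣) ∣T∣ ⟩
    φ (false ∷ T)               ∎
    where
    open ≡-Reasoning
    S∪t⊆W : S ∪ ⁅ t ⁆ ⊆ W
    S∪t⊆W = ∪-lub (drop-∷-⊆ S⊆W) (x∈p⇒⁅x⁆⊆p (drop-∷-⊆ T⊆W t∈T))

subsetSums-vanish⇒vanish : ∀ s r {n} (W : Subset n) (α : Subset n → ℚ) → s ≤ r → r + s ≤ ∣ W ∣ →
  (∀ e → e ⊆ W → ∣ e ∣ ≡ r → subsetSum s e α ≡ 0ℚ) → ∀ S → S ⊆ W → ∣ S ∣ ≡ s → α S ≡ 0ℚ
subsetSums-vanish⇒vanish zero r {n} W α _ r≤∣W∣ sums S _ ∣S∣≡0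
  with ⊆-extend ⊥ W r ⊥⊆ (subst (_≤ r) (sym (∣⊥∣≡0 n)) z≤n) (ℕP.≤-trans (ℕP.m≤m+n r 0) r≤∣W∣)
... | e , _ , e⊆W , ∣e∣≡r = begin
  α S               ≡⟨ cong α (∣p∣≡0⇒p≡⊥ ∣S∣≡0) ⟩
  α ⊥               ≡⟨ sym (subsetSum-zero e α) ⟩
  subsetSum 0 e α   ≡⟨ sums e e⊆W ∣e∣≡r ⟩
  0ℚ                ∎
  where open ≡-Reasoning
subsetSums-vanish⇒vanish (suc s) (suc r) W α (s≤s s≤r) size sums S S⊆W ∣S∣≡1+s
  with ⊆-extend S W (suc r) S⊆W (ℕP.≤-trans (ℕP.≤-reflexive ∣S∣≡1+s) (s≤s s≤r))
                                (ℕP.≤-trans (ℕP.m≤m+n (suc r) (suc s)) size)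
... | e , S⊆e , e⊆W , ∣e∣≡1+r = m·a≡0⇒a≡0 (α S) (0<nCk (subst (suc s ≤_) (sym ∣e∣≡1+r) (s≤s s≤r))) (begin
  (∣ e ∣ C suc s) · α S   ≡⟨ sym (subsetSum-const (suc s) e λ T T⊆e ∣T∣≡1+s → swapInvariant⇒constant
                               s W α swapInvariant T S (⊆-trans T⊆e e⊆W) S⊆W ∣T∣≡1+s ∣S∣≡1+s) ⟩
  subsetSum (suc s) e α   ≡⟨ sums e e⊆W ∣e∣≡1+r ⟩
  0ℚ                      ∎)
  where
  open ≡-Reasoning
  -- the differences α (T ∪ {z}) − α (T ∪ {y}) satisfy the hypothesis for (s , r) on W − y − z
  swapInvariant : SwapInvariant s W α
  swapInvariant y z y∈W z∈W y≢z U U⊆W y∉U z∉U ∣U∣≡s =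
    ℚ-x∙y⁻¹≈ε⇒x≈y _ _ (subsetSums-vanish⇒vanish s r (W - y - z) δ s≤r size′ sums′
                         U (p⊆q∧x∉p⇒p⊆q-x (p⊆q∧x∉p⇒p⊆q-x U⊆W y∉U) z∉U) ∣U∣≡s)
    where
    δ : Subset _ → ℚ
    δ T = α (T ∪ ⁅ z ⁆) ℚ.- α (T ∪ ⁅ y ⁆)
    size′ : r + s ≤ ∣ W - y - z ∣
    size′ = ℕ.s≤s⁻¹ (ℕ.s≤s⁻¹ (subst₂ _≤_ (cong suc (ℕP.+-suc r s)) (sym (2+∣p-x-y∣≡∣p∣ W y∈W z∈W y≢z)) size))
    sums′ : ∀ g → g ⊆ W - y - z → ∣ g ∣ ≡ r → subsetSum s g δ ≡ 0ℚ
    sums′ g g⊆W-y-z ∣g∣≡r = begin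
      subsetSum s g δ
        ≡⟨ subsetSum-swap s g α y∉g z∉g ⟩
      subsetSum (suc s) (g ∪ ⁅ z ⁆) α ℚ.- subsetSum (suc s) (g ∪ ⁅ y ⁆) α
        ≡⟨ cong₂ ℚ._-_ (sum∪ z∈W z∉g) (sum∪ y∈W y∉g) ⟩
      0ℚ ℚ.- 0ℚ
        ≡⟨ ℚP.+-inverseʳ 0ℚ ⟩
      0ℚ ∎
      where
      g⊆W-y : g ⊆ W - y
      g⊆W-y = ⊆-trans g⊆W-y-z (p-x⊆p (W - y) z)
      g⊆W : g ⊆ W
      g⊆W = ⊆-trans g⊆W-y (p-x⊆p W y)
      y∉g : y ∉ g
      y∉g = x∉p-x W y ∘ g⊆W-y
      z∉g : z ∉ g
      z∉g = x∉p-x (W - y) z ∘ g⊆W-y-z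
      sum∪ : ∀ {x} → x ∈ W → x ∉ g → subsetSum (suc s) (g ∪ ⁅ x ⁆) α ≡ 0ℚ
      sum∪ {x} x∈W x∉g = sums (g ∪ ⁅ x ⁆) (∪-lub g⊆W (x∈p⇒⁅x⁆⊆p x∈W))
                              (trans (x∉p⇒∣p∪⁅x⁆∣≡1+∣p∣ g x x∉g) (cong suc ∣g∣≡r))

-- Sets meeting a fixed set in many points

meetCount : ∀ {n} → Subset n → ℕ → ℕ → ℕ
meetCount {n} f k u = count (λ e → u ℕP.≤? ∣ f ∩ e ∣) (kSets n k)

meetCount-zero : ∀ {n} (f : Subset n) k → meetCount f k 0 ≡ n C k
meetCount-zero {n} f k = trans
  (cong length (ListP.filter-all (λ e → 0 ℕP.≤? ∣ f ∩ e ∣) (All.universal (λ _ → z≤n) (kSets n k))))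
  (length-kSets n k)

meetCount-none : ∀ {n} (f : Subset n) k u → (∀ e → ∣ e ∣ ≡ k → ∣ f ∩ e ∣ < u) → meetCount f k u ≡ 0
meetCount-none f k u small =
  count-none (λ e → u ℕP.≤? ∣ f ∩ e ∣) (All.tabulate λ e∈ → ℕP.<⇒≱ (small _ (∈-kSets⁻ e∈)))

-- choose u points of f, then the remaining k ∸ u points among the other n ∸ u
mutual
  meetCount≤ : ∀ {n} (f : Subset n) k u → meetCount f k u ≤ (∣ f ∣ C u) * ((n ∸ u) C (k ∸ u))
  meetCount≤ {n} f k zero = ℕP.≤-reflexive (trans (meetCount-zero f k) (sym (ℕP.+-identityʳ (n C k))))
  meetCount≤ f k (suc u) with suc u ℕP.≤? k | suc u ℕP.≤? ∣ f ∣
  ... | no 1+u≰k | _ = ℕP.≤-trans (ℕP.≤-reflexive (meetCount-none f k (suc u) λ e ∣e∣≡k →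
                         ℕP.≤-<-trans (∣p∩q∣≤∣q∣ f e) (subst (_< suc u) (sym ∣e∣≡k) (ℕP.≰⇒> 1+u≰k)))) z≤n
  ... | yes _ | no 1+u≰∣f∣ = ℕP.≤-trans (ℕP.≤-reflexive (meetCount-none f k (suc u) λ e _ →
                         ℕP.≤-<-trans (∣p∩q∣≤∣p∣ f e) (ℕP.≰⇒> 1+u≰∣f∣))) z≤n
  ... | yes 1+u≤k | yes 1+u≤∣f∣ = meetCount≤-large f k u 1+u≤k 1+u≤∣f∣

  meetCount≤-large : ∀ {n} (f : Subset n) k u → suc u ≤ k → suc u ≤ ∣ f ∣ →
    meetCount f k (suc u) ≤ (∣ f ∣ C suc u) * ((n ∸ suc u) C (k ∸ suc u))
  meetCount≤-large {suc n} (true ∷ f) (suc k) u _ _ = begin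
    meetCount (true ∷ f) (suc k) (suc u)
      ≡⟨ count-kSets-suc (λ e → suc u ℕP.≤? ∣ (true ∷ f) ∩ e ∣) k ⟩
    meetCount f (suc k) (suc u) + count (λ e → suc u ℕP.≤? suc ∣ f ∩ e ∣) (kSets n k)
      ≡⟨ cong (_+_ (meetCount f (suc k) (suc u))) (cong length (ListP.filter-≐
           (λ e → suc u ℕP.≤? suc ∣ f ∩ e ∣) (λ e → u ℕP.≤? ∣ f ∩ e ∣) (ℕ.s≤s⁻¹ , s≤s) (kSets n k))) ⟩
    meetCount f (suc k) (suc u) + meetCount f k u
      ≤⟨ ℕP.+-mono-≤ (meetCount≤ f (suc k) (suc u)) (meetCount≤ f k u) ⟩
    (∣ f ∣ C suc u) * ((n ∸ suc u) C (k ∸ u)) + (∣ f ∣ C u) * Y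
      ≤⟨ ℕP.+-monoˡ-≤ ((∣ f ∣ C u) * Y)
           (ℕP.*-monoʳ-≤ (∣ f ∣ C suc u) (C-monoˡ-≤ (k ∸ u) (ℕP.∸-monoʳ-≤ n (ℕP.n≤1+n u)))) ⟩
    (∣ f ∣ C suc u) * Y + (∣ f ∣ C u) * Y
      ≡⟨ sym (ℕP.*-distribʳ-+ Y (∣ f ∣ C suc u) (∣ f ∣ C u)) ⟩
    (∣ f ∣ C suc u + ∣ f ∣ C u) * Y
      ≡⟨ cong (_* Y) (trans (ℕP.+-comm (∣ f ∣ C suc u) (∣ f ∣ C u)) (nCk+nC[k+1]≡[n+1]C[k+1] ∣ f ∣ u)) ⟩
    (suc ∣ f ∣ C suc u) * Y ∎
    where
    open ℕP.≤-Reasoning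
    Y = (n ∸ u) C (k ∸ u)
  meetCount≤-large {suc n} (false ∷ f) (suc k) u (s≤s u≤k) 1+u≤∣f∣ with ℕP.m≤n⇒m<n∨m≡n u≤k
  ... | inj₁ u<k = begin
    meetCount (false ∷ f) (suc k) (suc u)
      ≡⟨ count-kSets-suc (λ e → suc u ℕP.≤? ∣ (false ∷ f) ∩ e ∣) k ⟩
    meetCount f (suc k) (suc u) + meetCount f k (suc u)
      ≤⟨ ℕP.+-mono-≤ (meetCount≤ f (suc k) (suc u)) (meetCount≤ f k (suc u)) ⟩
    a * ((n ∸ suc u) C (k ∸ u)) + a * ((n ∸ suc u) C (k ∸ suc u))
      ≡⟨ sym (ℕP.*-distribˡ-+ a ((n ∸ suc u) C (k ∸ u)) ((n ∸ suc u) C (k ∸ suc u))) ⟩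
    a * ((n ∸ suc u) C (k ∸ u) + (n ∸ suc u) C (k ∸ suc u))
      ≡⟨ cong (a *_) (C-pascal-∸ u<k (ℕP.≤-trans 1+u≤∣f∣ (∣p∣≤n f))) ⟩
    a * ((n ∸ u) C (k ∸ u)) ∎
    where
    open ℕP.≤-Reasoning
    a = ∣ f ∣ C suc u
  ... | inj₂ refl = begin
    meetCount (false ∷ f) (suc u) (suc u)
      ≡⟨ count-kSets-suc (λ e → suc u ℕP.≤? ∣ (false ∷ f) ∩ e ∣) u ⟩
    meetCount f (suc u) (suc u) + meetCount f u (suc u)
      ≡⟨ cong (_+_ (meetCount f (suc u) (suc u))) (meetCount-none f u (suc u) λ e ∣e∣≡u →
           ℕP.≤-<-trans (∣p∩q∣≤∣q∣ f e) (ℕP.≤-reflexive (cong suc ∣e∣≡u))) ⟩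
    meetCount f (suc u) (suc u) + 0
      ≡⟨ ℕP.+-identityʳ _ ⟩
    meetCount f (suc u) (suc u)
      ≤⟨ meetCount≤ f (suc u) (suc u) ⟩
    a * ((n ∸ suc u) C (u ∸ u))
      ≡⟨ cong (λ j → a * ((n ∸ suc u) C j)) (ℕP.n∸n≡0 u) ⟩
    a * 1
      ≡⟨ cong (λ j → a * ((n ∸ u) C j)) (sym (ℕP.n∸n≡0 u)) ⟩
    a * ((n ∸ u) C (u ∸ u)) ∎
    where
    open ℕP.≤-Reasoning
    a = ∣ f ∣ C suc u

-- Large independent sets

-- every r-subset of an (r + s)-set W with e ⊆ W ⊆ I meets e in ≥ r ∸ s points, so it is an edge of G
independent-avoiding-close : ∀ {n} r s (F : List (Subset n)) (α : Subset n → ℚ) → s ≤ r →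
  IsDependenceSeq r s F α → ∀ e I → ∣ e ∣ ≡ r → e ⊆ I → (∀ f → f ∈ₗ F → r ∸ s ≤ ∣ f ∩ e ∣ → ¬ (f ⊆ I)) →
  r + s ≤ ∣ I ∣ → IndependentIn s α I
independent-avoiding-close {n} r s F α s≤r dep e I ∣e∣≡r e⊆I close⊈I r+s≤∣I∣ S ∣S∣≡s αS≢0 S⊆I
  with ⊆-extend (e ∪ S) I (r + s) (∪-lub e⊆I S⊆I) ∣e∪S∣≤r+s r+s≤∣I∣
  where
  ∣e∪S∣≤r+s : ∣ e ∪ S ∣ ≤ r + s
  ∣e∪S∣≤r+s = ℕP.≤-trans (∣p∪q∣≤∣p∣+∣q∣ e S) (ℕP.≤-reflexive (cong₂ _+_ ∣e∣≡r ∣S∣≡s))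
... | W , e∪S⊆W , W⊆I , ∣W∣≡r+s =
  αS≢0 (subsetSums-vanish⇒vanish s r W α s≤r (ℕP.≤-reflexive (sym ∣W∣≡r+s)) sums S (e∪S⊆W ∘ q⊆p∪q e S) ∣S∣≡s)
  where
  sums : ∀ e′ → e′ ⊆ W → ∣ e′ ∣ ≡ r → subsetSum s e′ α ≡ 0ℚ
  sums e′ e′⊆W ∣e′∣≡r = trans (sym (Σ-kSets≡subsetSum n s e′ α)) (dep e′ (∣e′∣≡r , e′∉F))
    where
    ∣e′∪e∣≤r+s : ∣ e′ ∪ e ∣ ≤ r + s
    ∣e′∪e∣≤r+s = ℕP.≤-trans (p⊆q⇒∣p∣≤∣q∣ (∪-lub e′⊆W (e∪S⊆W ∘ p⊆p∪q S))) (ℕP.≤-reflexive ∣W∣≡r+s)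
    e′∉F : ¬ (e′ ∈ₗ F)
    e′∉F e′∈F = close⊈I e′ e′∈F (r∸s≤∣p∩q∣ e′ e s≤r ∣e′∣≡r ∣e∣≡r ∣e′∪e∣≤r+s) (⊆-trans e′⊆W W⊆I)

closeTo? : ∀ {n} r s (e f : Subset n) → Dec (r ∸ s ≤ ∣ f ∩ e ∣)
closeTo? r s e f = r ∸ s ℕP.≤? ∣ f ∩ e ∣

closeCount : ∀ {n} r s (F : List (Subset n)) → Subset n → ℕ
closeCount r s F e = count (closeTo? r s e) F

avoidClose : ∀ {n} r s (F : List (Subset n)) → Subset n → Subset n
avoidClose r s F e = ∁ (⋃ (map (λ f → leastSingleton (f ─ e)) (filter (closeTo? r s e) F)))

∣avoidClose∣ : ∀ {n} r s (F : List (Subset n)) e → n ∸ closeCount r s F e ≤ ∣ avoidClose r s F e ∣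
∣avoidClose∣ {n} r s F e = subst (n ∸ closeCount r s F e ≤_) (sym (∣∁p∣≡n∸∣p∣ (⋃ ps))) (ℕP.∸-monoʳ-≤ n (begin
  ∣ ⋃ ps ∣                                           ≤⟨ ∣⋃∣≤sum ps ⟩
  sum (map ∣_∣ ps)                                   ≡⟨ cong sum (sym (ListP.map-∘ close)) ⟩
  sum (map (λ f → ∣ leastSingleton (f ─ e) ∣) close) ≤⟨ sum-≤-length* _ 1 close (λ f _ →
                                                          ∣leastSingleton∣≤1 (f ─ e)) ⟩
  length close * 1                                   ≡⟨ ℕP.*-identityʳ (length close) ⟩
  length close                                       ∎))
  where
  open ℕP.≤-Reasoning
  close = filter (closeTo? r s e) F
  ps = map (λ f → leastSingleton (f ─ e)) close

e⊆avoidClose : ∀ {n} r s (F : List (Subset n)) e → e ⊆ avoidClose r s F e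
e⊆avoidClose r s F e x∈e = x∉p⇒x∈∁p (∉⋃ _ λ p p∈ps x∈p → x∉e p∈ps x∈p x∈e)
  where
  x∉e : ∀ {p x} → p ∈ₗ map (λ f → leastSingleton (f ─ e)) (filter (closeTo? r s e) F) → x ∈ p → x ∉ e
  x∉e p∈ps x∈p with ∈-map⁻ (λ f → leastSingleton (f ─ e)) p∈ps
  ... | f , _ , refl = x∈p─q⇒x∉q f e (leastSingleton⊆ (f ─ e) x∈p)

close⊈avoidClose : ∀ {n} r s (F : List (Subset n)) e → ∣ e ∣ ≡ r → ¬ (e ∈ₗ F) → All (λ f → ∣ f ∣ ≡ r) F →
  ∀ f → f ∈ₗ F → r ∸ s ≤ ∣ f ∩ e ∣ → ¬ (f ⊆ avoidClose r s F e)
close⊈avoidClose r s F e ∣e∣≡r e∉F ∣F∣≡r f f∈F close f⊆I with p⊈q⇒∃∈∉ f⊈e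
  where
  f⊈e : ¬ (f ⊆ e)
  f⊈e f⊆e = e∉F (subst (_∈ₗ F) (⊆∧∣≡∣⇒≡ f⊆e (trans (All.lookup ∣F∣≡r f∈F) (sym ∣e∣≡r))) f∈F)
... | x , x∈f , x∉e with leastSingleton-nonempty (x , x∈p∧x∉q⇒x∈p─q x∈f x∉e)
... | y , y∈⁅y⁆ = x∈p⇒x∉∁p (⊆⋃ ⁅y⁆∈ps y∈⁅y⁆) (f⊆I (p─q⊆p f e (leastSingleton⊆ (f ─ e) y∈⁅y⁆)))
  where
  ⁅y⁆∈ps : leastSingleton (f ─ e) ∈ₗ map (λ f → leastSingleton (f ─ e)) (filter (closeTo? r s e) F)
  ⁅y⁆∈ps = ∈-map⁺ (λ f → leastSingleton (f ─ e)) (∈-filter⁺ (closeTo? r s e) f∈F close)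

Σ-closeCount≤ : ∀ {n} r s (F : List (Subset n)) → s ≤ r → r ≤ n → All (λ f → ∣ f ∣ ≡ r) F →
  sum (map (closeCount r s F) (kSets n r)) ≤ length F * ((r C s) * ((n ∸ r + s) C s))
Σ-closeCount≤ {n} r s F s≤r r≤n ∣F∣≡r = begin
  sum (map (closeCount r s F) (kSets n r))   ≡⟨ sum-count-swap (closeTo? r s) (kSets n r) F ⟩
  sum (map (λ f → meetCount f r (r ∸ s)) F)  ≤⟨ sum-≤-length* _ _ F meetCount≤bound ⟩
  length F * ((r C s) * ((n ∸ r + s) C s))   ∎
  where
  open ℕP.≤-Reasoning
  meetCount≤bound : ∀ f → f ∈ₗ F → meetCount f r (r ∸ s) ≤ (r C s) * ((n ∸ r + s) C s)
  meetCount≤bound f f∈F = ℕP.≤-trans (meetCount≤ f r (r ∸ s)) (ℕP.≤-reflexive (cong₂ _*_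
    (trans (cong (_C (r ∸ s)) (All.lookup ∣F∣≡r f∈F)) (sym (nCk≡nC[n∸k] s≤r)))
    (cong₂ _C_ (n∸[r∸s]≡n∸r+s s≤r r≤n) (ℕP.m∸[m∸n]≡n s≤r))))

_≟ₛ_ : ∀ {n} → DecidableEquality (Subset n)
_≟ₛ_ = VecP.≡-dec Bool._≟_

_∈F?_ : ∀ {n} (e : Subset n) F → Dec (e ∈ₗ F)
e ∈F? F = any? (e ≟ₛ_) F

edges : ∀ {n} → ℕ → List (Subset n) → List (Subset n)
edges {n} r F = filter (λ e → ¬? (e ∈F? F)) (kSets n r)

count-∈≤length : ∀ {n} k (F : List (Subset n)) → count (_∈F? F) (kSets n k) ≤ length F
count-∈≤length {n} k F = begin
  count (_∈F? F) (kSets n k)                      ≤⟨ count≤sum (_∈F? F) (λ e → count (e ≟ₛ_) F)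
                                                        (λ e → ListP.filter-some (e ≟ₛ_)) (kSets n k) ⟩
  sum (map (λ e → count (e ≟ₛ_) F) (kSets n k))  ≡⟨ sum-count-swap _≟ₛ_ (kSets n k) F ⟩
  sum (map (λ f → count (_≟ₛ f) (kSets n k)) F)  ≤⟨ sum-≤-length* _ 1 F (λ f _ →
                                                        Unique⇒count≤1 _≟ₛ_ f (kSets-unique n k)) ⟩
  length F * 1                                    ≡⟨ ℕP.*-identityʳ (length F) ⟩
  length F                                        ∎
  where open ℕP.≤-Reasoning

nCr≤∣F∣+∣edges∣ : ∀ {n} r (F : List (Subset n)) → n C r ≤ length F + length (edges r F)
nCr≤∣F∣+∣edges∣ {n} r F = begin
  n C r                                            ≡⟨ sym (length-kSets n r) ⟩
  length (kSets n r)                               ≡⟨ sym (count+count-¬ (_∈F? F) (kSets n r)) ⟩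
  count (_∈F? F) (kSets n r) + length (edges r F)  ≤⟨ ℕP.+-monoˡ-≤ (length (edges r F)) (count-∈≤length r F) ⟩
  length F + length (edges r F)                    ∎
  where open ℕP.≤-Reasoning

m≤n∸o⇒o≤n∸m : ∀ {m n o} → o ≤ n → m ≤ n ∸ o → o ≤ n ∸ m
m≤n∸o⇒o≤n∸m {m} {n} {o} o≤n m≤n∸o = ℕP.m+n≤o⇒m≤o∸n o (subst (_≤ n) (ℕP.+-comm m o) (ℕP.m≤o∸n⇒m+n≤o m o≤n m≤n∸o))

-- average the close counts over the edges of G
large-independent-set : ∀ {n} r s (F : List (Subset n)) (α : Subset n → ℚ) → s ≤ r → r ≤ n →
  All (λ f → ∣ f ∣ ≡ r) F → IsDependenceSeq r s F α →
  ∀ d → 0 < d → d ≤ length (edges r F) → s ≤ n ∸ r →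
  length F * (r C s) * ((n ∸ r + s) C s) ≤ (n ∸ r ∸ s) * d →
  ∃ λ I → IndependentIn s α I × n * d ≤ ∣ I ∣ * d + length F * (r C s) * ((n ∸ r + s) C s)
large-independent-set {n} r s F α s≤r r≤n ∣F∣≡r dep d 0<d d≤∣L∣ s≤n∸r X≤[n∸r∸s]d
  with ∃-≤-average (closeCount r s F) (edges r F) (ℕP.≤-trans 0<d d≤∣L∣)
... | e , e∈L , b[e]∣L∣≤Σb =
  I , independent-avoiding-close r s F α s≤r dep e I ∣e∣≡r (e⊆avoidClose r s F e)
        (close⊈avoidClose r s F e ∣e∣≡r e∉F ∣F∣≡r) r+s≤∣I∣
    , (begin
  n * d                      ≡⟨ cong (_* d) (sym (ℕP.m∸n+n≡m b[e]≤n)) ⟩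
  (n ∸ b e + b e) * d        ≡⟨ ℕP.*-distribʳ-+ d (n ∸ b e) (b e) ⟩
  (n ∸ b e) * d + b e * d    ≤⟨ ℕP.+-mono-≤ (ℕP.*-monoˡ-≤ d (∣avoidClose∣ r s F e)) b[e]d≤X ⟩
  ∣ I ∣ * d + X              ∎)
  where
  open ℕP.≤-Reasoning
  X = length F * (r C s) * ((n ∸ r + s) C s)
  b = closeCount r s F
  I = avoidClose r s F e
  ∣e∣≡r : ∣ e ∣ ≡ r
  ∣e∣≡r = ∈-kSets⁻ (proj₁ (∈-filter⁻ (λ e → ¬? (e ∈F? F)) {xs = kSets n r} e∈L))
  e∉F : ¬ (e ∈ₗ F)
  e∉F = proj₂ (∈-filter⁻ (λ e → ¬? (e ∈F? F)) {xs = kSets n r} e∈L)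
  b[e]d≤X : b e * d ≤ X
  b[e]d≤X = begin
    b e * d                                   ≤⟨ ℕP.*-monoʳ-≤ (b e) d≤∣L∣ ⟩
    b e * length (edges r F)                  ≤⟨ b[e]∣L∣≤Σb ⟩
    sum (map b (edges r F))                   ≤⟨ sum-filter-≤ (λ e → ¬? (e ∈F? F)) b (kSets n r) ⟩
    sum (map b (kSets n r))                   ≤⟨ Σ-closeCount≤ r s F s≤r r≤n ∣F∣≡r ⟩
    length F * ((r C s) * ((n ∸ r + s) C s))  ≡⟨ sym (ℕP.*-assoc (length F) (r C s) ((n ∸ r + s) C s)) ⟩
    X                                         ∎
  b[e]≤n∸[r+s] : b e ≤ n ∸ (r + s)
  b[e]≤n∸[r+s] = subst (b e ≤_) (ℕP.∸-+-assoc n r s)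
    (ℕP.*-cancelʳ-≤ (b e) (n ∸ r ∸ s) d {{ℕ.>-nonZero 0<d}} (ℕP.≤-trans b[e]d≤X X≤[n∸r∸s]d))
  b[e]≤n : b e ≤ n
  b[e]≤n = ℕP.≤-trans b[e]≤n∸[r+s] (ℕP.m∸n≤m n (r + s))
  r+s≤∣I∣ : r + s ≤ ∣ I ∣
  r+s≤∣I∣ = ℕP.≤-trans (m≤n∸o⇒o≤n∸m (subst (_≤ n) (ℕP.+-comm s r) (ℕP.m≤o∸n⇒m+n≤o s r≤n s≤n∸r)) b[e]≤n∸[r+s])
                       (∣avoidClose∣ r s F e)

+m-+n≡+[m∸n] : ∀ {m n} → n ≤ m → + m ℤ.- + n ≡ + (m ∸ n)
+m-+n≡+[m∸n] {m} {n} n≤m = trans (ℤP.m-n≡m⊖n m n) (ℤP.⊖-≥ n≤m)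

+m-+n≡-[n∸m] : ∀ {m n} → m ≤ n → + m ℤ.- + n ≡ ℤ.- + (n ∸ m)
+m-+n≡-[n∸m] {m} {n} m≤n = trans (ℤP.m-n≡m⊖n m n) (ℤP.⊖-≤ m≤n)

+m*-+n≡-+[m*n] : ∀ m n → + m ℤ.* ℤ.- + n ≡ ℤ.- + (m * n)
+m*-+n≡-+[m*n] m n = trans (sym (ℤP.neg-distribʳ-* (+ m) (+ n))) (cong ℤ.-_ (sym (ℤP.pos-* m n)))

-+m*+n≡-+[m*n] : ∀ m n → ℤ.- + m ℤ.* + n ≡ ℤ.- + (m * n)
-+m*+n≡-+[m*n] m n = trans (sym (ℤP.neg-distribˡ-* (+ m) (+ n))) (cong ℤ.-_ (sym (ℤP.pos-* m n)))

+m≤-+n⇒m≡0∧n≡0 : ∀ {m n} → + m ℤ.≤ ℤ.- + n → m ≡ 0 × n ≡ 0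
+m≤-+n⇒m≡0∧n≡0 {n = zero} (ℤ.+≤+ m≤0) = ℕP.n≤0⇒n≡0 m≤0 , refl

-+m-+n≤0 : ∀ m n → ℤ.- + m ℤ.- + n ℤ.≤ ℤ.0ℤ
-+m-+n≤0 m n = subst (ℤ._≤ ℤ.0ℤ) -+m-+n≡-+[m+n] ℤP.neg-≤-pos
  where
  -+m-+n≡-+[m+n] : ℤ.- + (m + n) ≡ ℤ.- + m ℤ.- + n
  -+m-+n≡-+[m+n] = trans (cong ℤ.-_ (ℤP.pos-+ m n)) (ℤP.neg-distrib-+ (+ m) (+ n))

[+a-+s]*+d≥+x⇒ : ∀ a s d x → 0 < d → (+ a ℤ.- + s) ℤ.* + d ℤ.≥ + x → s ≤ a × x ≤ (a ∸ s) * d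
[+a-+s]*+d≥+x⇒ a s d x 0<d x≤[a-s]d with s ℕP.≤? a
... | yes s≤a = s≤a , ℤP.drop‿+≤+ (subst (+ x ℤ.≤_) [a-s]d≡+[a∸s]d x≤[a-s]d)
  where
  [a-s]d≡+[a∸s]d : (+ a ℤ.- + s) ℤ.* + d ≡ + ((a ∸ s) * d)
  [a-s]d≡+[a∸s]d = trans (cong (ℤ._* + d) (+m-+n≡+[m∸n] s≤a)) (sym (ℤP.pos-* (a ∸ s) d))
... | no s≰a = contradiction (ℕP.m∸n≡0⇒m≤n [s∸a]≡0) s≰a
  where
  [a-s]d≡-[s∸a]d : (+ a ℤ.- + s) ℤ.* + d ≡ ℤ.- + ((s ∸ a) * d)
  [a-s]d≡-[s∸a]d = trans (cong (ℤ._* + d) (+m-+n≡-[n∸m] (ℕP.<⇒≤ (ℕP.≰⇒> s≰a)))) (-+m*+n≡-+[m*n] (s ∸ a) d)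
  [s∸a]≡0 : s ∸ a ≡ 0
  [s∸a]≡0 = ℕP.m*n≡0⇒m≡0 (s ∸ a) d {{ℕ.>-nonZero 0<d}}
              (proj₂ (+m≤-+n⇒m≡0∧n≡0 (subst (+ x ℤ.≤_) [a-s]d≡-[s∸a]d x≤[a-s]d)))

n*d≤i*d+x⇒ : ∀ n i d x → n * d ≤ i * d + x → + i ℤ.* + d ℤ.≥ + n ℤ.* + d ℤ.- + x
n*d≤i*d+x⇒ n i d x nd≤id+x =
  subst₂ (λ a b → a ℤ.- + x ℤ.≤ b) (ℤP.pos-* n d) (ℤP.pos-* i d) (by-cases (x ℕP.≤? n * d))
  where
  by-cases : Dec (x ≤ n * d) → + (n * d) ℤ.- + x ℤ.≤ + (i * d)
  by-cases (yes x≤nd) = subst (ℤ._≤ + (i * d)) (sym (+m-+n≡+[m∸n] x≤nd))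
    (ℤ.+≤+ (ℕP.m≤n+o⇒m∸n≤o (n * d) x (subst (n * d ≤_) (ℕP.+-comm (i * d) x) nd≤id+x)))
  by-cases (no x≰nd) = subst (ℤ._≤ + (i * d)) (sym (+m-+n≡-[n∸m] (ℕP.<⇒≤ (ℕP.≰⇒> x≰nd)))) ℤP.neg-≤-pos

∅-independent : ∀ {n} s (α : Subset n → ℚ) → IndependentIn (suc s) α ⊥
∅-independent {n} s α S ∣S∣≡1+s _ S⊆⊥ = contradiction (subst₂ _≤_ ∣S∣≡1+s (∣⊥∣≡0 n) (p⊆q⇒∣p∣≤∣q∣ S⊆⊥)) λ ()

-- with no edges the empty set works, except for s = 0, where the hypothesis cannot hold
lemma12-nCr≤∣F∣ : ∀ n r s (F : List (Subset n)) (α : Subset n → ℚ) → r ≤ n → n C r ≤ length F →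
  (+ n ℤ.- + r ℤ.- + s) ℤ.* (+ (n C r) ℤ.- + length F) ℤ.≥ + (length F * (r C s) * ((n ∸ r + s) C s)) →
  Σ (Subset n) λ I → IndependentIn s α I ×
    (+ ∣ I ∣ ℤ.* (+ (n C r) ℤ.- + length F)
       ℤ.≥ + n ℤ.* (+ (n C r) ℤ.- + length F) ℤ.- + (length F * (r C s) * ((n ∸ r + s) C s)))
lemma12-nCr≤∣F∣ n r zero F α r≤n nCr≤∣F∣ hyp =
  contradiction (subst (n C r ≤_) ∣F∣≡0 nCr≤∣F∣) (ℕP.<⇒≱ (0<nCk r≤n))
  where
  D≡-[∣F∣∸nCr] : + (n C r) ℤ.- + length F ≡ ℤ.- + (length F ∸ n C r)
  D≡-[∣F∣∸nCr] = +m-+n≡-[n∸m] nCr≤∣F∣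
  hyp′ : + (length F * 1 * 1) ℤ.≤ ℤ.- + ((n ∸ r) * (length F ∸ n C r))
  hyp′ = subst (+ (length F * 1 * 1) ℤ.≤_)
    (trans (cong₂ ℤ._*_ (trans (ℤP.+-identityʳ _) (+m-+n≡+[m∸n] r≤n)) D≡-[∣F∣∸nCr])
           (+m*-+n≡-+[m*n] (n ∸ r) (length F ∸ n C r))) hyp
  ∣F∣≡0 : length F ≡ 0
  ∣F∣≡0 = trans (sym (trans (ℕP.*-identityʳ (length F * 1)) (ℕP.*-identityʳ (length F))))
                (proj₁ (+m≤-+n⇒m≡0∧n≡0 hyp′))
lemma12-nCr≤∣F∣ n r (suc s) F α r≤n nCr≤∣F∣ _ = ⊥ , ∅-independent s α , (begin
  + n ℤ.* D ℤ.- + X                          ≡⟨ cong (λ D → + n ℤ.* D ℤ.- + X) (+m-+n≡-[n∸m] nCr≤∣F∣) ⟩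
  + n ℤ.* ℤ.- + (length F ∸ n C r) ℤ.- + X   ≡⟨ cong (ℤ._- + X) (+m*-+n≡-+[m*n] n (length F ∸ n C r)) ⟩
  ℤ.- + (n * (length F ∸ n C r)) ℤ.- + X     ≤⟨ -+m-+n≤0 (n * (length F ∸ n C r)) X ⟩
  ℤ.0ℤ                                       ≡⟨ sym (trans (cong (λ m → + m ℤ.* D) (∣⊥∣≡0 n)) (ℤP.*-zeroˡ D)) ⟩
  + ∣ ⊥ {n} ∣ ℤ.* D                          ∎)
  where
  open ℤP.≤-Reasoning
  D = + (n C r) ℤ.- + length F
  X = length F * (r C suc s) * ((n ∸ r + suc s) C suc s)

lemma12-∣F∣<nCr : ∀ n r s (F : List (Subset n)) (α : Subset n → ℚ) → s ≤ r → r ≤ n → All (λ e → ∣ e ∣ ≡ r) F →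
  IsDependenceSeq r s F α → length F < n C r →
  (+ n ℤ.- + r ℤ.- + s) ℤ.* (+ (n C r) ℤ.- + length F) ℤ.≥ + (length F * (r C s) * ((n ∸ r + s) C s)) →
  Σ (Subset n) λ I → IndependentIn s α I ×
    (+ ∣ I ∣ ℤ.* (+ (n C r) ℤ.- + length F)
       ℤ.≥ + n ℤ.* (+ (n C r) ℤ.- + length F) ℤ.- + (length F * (r C s) * ((n ∸ r + s) C s)))
lemma12-∣F∣<nCr n r s F α s≤r r≤n ∣F∣≡r dep ∣F∣<nCr hyp =
  I , independent ,
  subst (λ D → + ∣ I ∣ ℤ.* D ℤ.≥ + n ℤ.* D ℤ.- + X) (sym D≡+d) (n*d≤i*d+x⇒ n ∣ I ∣ d X nd≤∣I∣d+X)
  where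
  X = length F * (r C s) * ((n ∸ r + s) C s)
  d = n C r ∸ length F
  D≡+d : + (n C r) ℤ.- + length F ≡ + d
  D≡+d = +m-+n≡+[m∸n] (ℕP.<⇒≤ ∣F∣<nCr)
  0<d : 0 < d
  0<d = ℕP.m<n⇒0<n∸m ∣F∣<nCr
  hypothesis : s ≤ n ∸ r × X ≤ (n ∸ r ∸ s) * d
  hypothesis = [+a-+s]*+d≥+x⇒ (n ∸ r) s d X 0<d
    (subst₂ (λ A D → A ℤ.* D ℤ.≥ + X) (cong (ℤ._- + s) (+m-+n≡+[m∸n] r≤n)) D≡+d hyp)
  d≤∣edges∣ : d ≤ length (edges r F)
  d≤∣edges∣ = ℕP.m≤n+o⇒m∸n≤o (n C r) (length F) (nCr≤∣F∣+∣edges∣ r F)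
  result = large-independent-set r s F α s≤r r≤n ∣F∣≡r dep d 0<d d≤∣edges∣ (proj₁ hypothesis) (proj₂ hypothesis)
  I = proj₁ result
  independent = proj₁ (proj₂ result)
  nd≤∣I∣d+X = proj₂ (proj₂ result)

lemma12 : (n r s : ℕ) → s ≤ r → r ≤ n →
    (F : List (Subset n)) → Unique F → All (λ e → ∣ e ∣ ≡ r) F →
    ¬ RankAtLeast r s F (n C s) →
    (+ n ℤ.- + r ℤ.- + s) ℤ.* (+ (n C r) ℤ.- + length F)
      ℤ.≥ + (length F ℕ.* (r C s) ℕ.* ((n ∸ r ℕ.+ s) C s)) →
    (α : Subset n → ℚ) → IsDependenceSeq r s F α →
    Σ (Subset n) λ I → IndependentIn s α I ×
      (+ ∣ I ∣ ℤ.* (+ (n C r) ℤ.- + length F)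
        ℤ.≥ + n ℤ.* (+ (n C r) ℤ.- + length F)
            ℤ.- + (length F ℕ.* (r C s) ℕ.* ((n ∸ r ℕ.+ s) C s)))
lemma12 n r s s≤r r≤n F _ ∣F∣≡r _ hyp α dep with n C r ℕP.≤? length F
... | yes nCr≤∣F∣ = lemma12-nCr≤∣F∣ n r s F α r≤n nCr≤∣F∣ hyp
... | no nCr≰∣F∣ = lemma12-∣F∣<nCr n r s F α s≤r r≤n ∣F∣≡r dep (ℕP.≰⇒> nCr≰∣F∣) hyp
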